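{- For every integer $k>0$, $a(2k,k)=(k+3)2^{k-2}$ and $a(2k+1,k)=(k+2)2^{k-1}$.
   Context: $\Bbbk$ is a field of characteristic $0$; $\mathcal{M}$ is the free monoid on letters $D,U$; $\mathcal{W}=\Bbbk\langle D,U\mid DU-UD=1\rangle$; $\phi:\mathcal{M}\to\mathcal{W}$ is the monoid morphism with $D\mapsto D,U\mapsto U$. Words $u,v$ are Weyl-equivalent if $\phi(u)=\phi(v)$. For $0\le k\le n$, $a(n,k)$ is the number of Weyl-equivalence classes of words with $k$ letters $D$ and $n-k$ letters $U$. -}

module Defs where

open import Data.Nat using (ℕ; zero; suc; _+_; _*_)
open import Data.Nat.Properties using (_≟_)
open import Data.Product using (Σ; _×_; _,_)
open import Data.List using (List; []; _∷_; map; concatMap; length)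
open import Data.List.Relation.Unary.All using (All)
open import Data.List.Relation.Unary.Any using (Any)
open import Data.List.Relation.Unary.AllPairs using (AllPairs)
open import Relation.Nullary using (¬_; yes; no)
open import Relation.Binary.PropositionalEquality using (_≡_)

data Letter : Set where
  D U : Letter

Word : Set
Word = List Letter

countD : Word → ℕ
countD []      = 0
countD (D ∷ w) = suc (countD w)
countD (U ∷ w) = countD w

-- The Weyl algebra 𝓦 = 𝕜⟨D,U | DU - UD = 1⟩ has the (PBW) basis U^i D^j.
-- A term (c , i , j) stands for c · U^i D^j.  The image φ(w) of a word has
-- non-negative integer coefficients in this basis, so we compute it with
-- ℕ-coefficients (char 𝕜 = 0, so ℕ ↪ 𝕜 and nothing is lost).
Term : Set
Term = ℕ × ℕ × ℕ

mulU : Term → Term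
mulU (c , i , j) = (c , suc i , j)

-- left multiplication by D :  D · U^i D^j = U^i D^(j+1) + i U^(i-1) D^j
mulD : Term → List Term
mulD (c , zero  , j) = (c , zero , suc j) ∷ []
mulD (c , suc i , j) = (c , suc i , suc j) ∷ (c * suc i , i , j) ∷ []

-- φ(w), written as a (not yet collected) list of normal-ordered terms.
φ : Word → List Term
φ []      = (1 , 0 , 0) ∷ []
φ (U ∷ w) = map mulU (φ w)
φ (D ∷ w) = concatMap mulD (φ w)

coeff : List Term → ℕ → ℕ → ℕ
coeff []                  i j = 0
coeff ((c , i' , j') ∷ ts) i j with i' ≟ i | j' ≟ j
... | yes _ | yes _ = c + coeff ts i j
... | _     | _     = coeff ts i j

WeylEquiv : Word → Word → Set
WeylEquiv u v = ∀ i j → coeff (φ u) i j ≡ coeff (φ v) i j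

InClass : ℕ → ℕ → Word → Set
InClass n k w = (length w ≡ n) × (countD w ≡ k)

-- "a(n,k) = N": there is a list of N words with k D's and n-k U's, pairwise
-- not Weyl-equivalent, such that every such word is Weyl-equivalent to one
-- of them (a complete system of representatives of the classes).
NumClasses : ℕ → ℕ → ℕ → Set
NumClasses n k N =
  Σ (List Word) λ R →
    (length R ≡ N)
    × All (InClass n k) R
    × AllPairs (λ u v → ¬ WeylEquiv u v) R
    × (∀ w → InClass n k w → Any (WeylEquiv w) R)

{-# OPTIONS --safe #-}

-- Normal ordering writes a word w of height h = #U - #D as Σ_j c_j U^(j+h) D^j, and (c_j) is the
-- coefficient sequence, in the falling-factorial basis t(t-1)⋯(t-j+1), of ∏ (t + ℓ) where ℓ runs
-- over the levels of w: the heights of the suffixes that follow its letters D.  A product of linear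
-- factors determines its roots, so words of equal height are Weyl-equivalent iff their levels agree
-- as multisets.  Read from the right, w is a walk from height 0 to h, so its levels ≤ 0 and its
-- levels > h have no gaps and their multiplicities form two compositions.  For h = 0 (length 2k) the
-- classes thus correspond to pairs of compositions of total size k, and for h = 1 (length 2k+1) to
-- such pairs together with the multiplicity of level 1; explicit words realise every such datum.
-- Counting them with c_0 = 1 and c_i = 2^(i-1) compositions of i > 0 leads to the convolutions
-- Σ_{i+j=k} c_i c_j and Σ_{i+m+j=k} c_i c_j.

module Submission where

open import Defs
open import Data.Bool using (if_then_else_; _∧_)
open import Data.Bool.Properties using (∧-zeroʳ)
open import Data.Integer as ℤ using (ℤ; +_; -[1+_]; 0ℤ; 1ℤ; -1ℤ)
import Data.Integer.Properties as ℤ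
import Data.Integer.Tactic.RingSolver as ℤ
open import Algebra.Properties.AbelianGroup ℤ.+-0-abelianGroup using () renaming (∙-cancelˡ to +-cancelˡ; ∙-cancelʳ to +-cancelʳ)
open import Data.List using (List; []; _∷_; [_]; map; concatMap; _++_; length; filter; replicate; cartesianProduct)
open import Data.List.Properties using (length-++; length-map; filter-accept; filter-reject; filter-++; ++-identityʳ; ∷-injectiveʳ)
open import Data.List.Membership.Propositional using (_∈_)
open import Data.List.Membership.Propositional.Properties
  using (∈-∃++; ∈-filter⁺; ∈-map⁺; ∈-map⁻; ∈-++⁺ˡ; ∈-++⁺ʳ; ∈-++⁻; ∈-cartesianProduct⁺; ∈-cartesianProduct⁻)
open import Data.List.Relation.Binary.Disjoint.Propositional using (Disjoint)
open import Data.List.Relation.Binary.Permutation.Propositional as ↭ using (_↭_)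
open import Data.List.Relation.Binary.Permutation.Propositional.Properties using (shift; ↭-length; filter-↭)
open import Data.List.Relation.Unary.All as All using (All; []; _∷_)
import Data.List.Relation.Unary.All.Properties as All
open import Data.List.Relation.Unary.AllPairs as AllPairs using ([]; _∷_)
import Data.List.Relation.Unary.AllPairs.Properties as AllPairs
open import Data.List.Relation.Unary.Any as Any using (Any; here; there)
import Data.List.Relation.Unary.Any.Properties as Any
open import Data.List.Relation.Unary.Unique.Propositional using (Unique)
import Data.List.Relation.Unary.Unique.Propositional.Properties as Unique
open import Data.Nat as ℕ using (ℕ; zero; suc; _+_; _*_; _^_; _≤_; _<_; z≤n; s≤s)
import Data.Nat.Properties as ℕ
open import Data.Nat.Properties using (_≟_; +-assoc; +-identityʳ; *-comm; *-zeroʳ)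
open import Data.Nat.Tactic.RingSolver using (solve-∀)
open import Data.Product using (Σ; _×_; _,_; proj₁; proj₂; ∃₂)
open import Data.Sum using (inj₁; inj₂)
open import Function using (_∘_; _⇔_; mk⇔; Injective; Equivalence)
open import Relation.Binary using (tri<; tri≈; tri>)
open import Relation.Binary.PropositionalEquality hiding ([_])
open import Relation.Nullary using (does; yes; no; contradiction; ¬_)
open import Relation.Nullary.Decidable using (dec-true; dec-false)
open ≡-Reasoning

-- Stated with 1ℤ ℤ.+_ and -1ℤ ℤ.+_ (the definitions of ℤ.suc and ℤ.pred), which the ring solver can read.
private
  suc-transpose : ∀ {x y} → ℤ.suc x ≡ y → x ≡ ℤ.pred y
  suc-transpose {x} refl = sym (ℤ.pred-suc x)

  pred-transpose : ∀ {x y} → ℤ.pred x ≡ y → x ≡ ℤ.suc y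
  pred-transpose {x} refl = sym (ℤ.suc-pred x)

  suc-injective : ∀ {x y} → ℤ.suc x ≡ ℤ.suc y → x ≡ y
  suc-injective {y = y} e = trans (suc-transpose e) (ℤ.pred-suc y)

  +-sucʳ : ∀ x h → x ℤ.+ (1ℤ ℤ.+ h) ≡ 1ℤ ℤ.+ (x ℤ.+ h)
  +-sucʳ = ℤ.solve-∀

  suc-+-pred : ∀ x h → (1ℤ ℤ.+ x) ℤ.+ (-1ℤ ℤ.+ h) ≡ x ℤ.+ h
  suc-+-pred = ℤ.solve-∀

  suc-+≡+-suc : ∀ h k → (1ℤ ℤ.+ h) ℤ.+ k ≡ h ℤ.+ (1ℤ ℤ.+ k)
  suc-+≡+-suc = ℤ.solve-∀

  pred-+-suc : ∀ h k → (-1ℤ ℤ.+ h) ℤ.+ (1ℤ ℤ.+ k) ≡ h ℤ.+ k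
  pred-+-suc = ℤ.solve-∀

  -suc+1 : ∀ n → ℤ.- (1ℤ ℤ.+ n) ℤ.+ 1ℤ ≡ ℤ.- n
  -suc+1 = ℤ.solve-∀

  -n-1 : ∀ n → ℤ.- n ℤ.- 1ℤ ≡ ℤ.- (1ℤ ℤ.+ n)
  -n-1 = ℤ.solve-∀

  suc-1 : ∀ n → (1ℤ ℤ.+ n) ℤ.- 1ℤ ≡ n
  suc-1 = ℤ.solve-∀

  1≢-n : ∀ i → 1ℤ ≢ ℤ.- (+ i)
  1≢-n zero    ()
  1≢-n (suc i) ()

-- Falling-factorial polynomials

-- A polynomial in t, given by its coefficients in the falling-factorial basis t(t-1)⋯(t-j+1).
FFPoly : Set
FFPoly = ℕ → ℤ

-- (t + a) · p, using (t + a) · t(t-1)⋯(t-j+1) = t(t-1)⋯(t-j) + (j + a) · t(t-1)⋯(t-j+1).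
mulLinear : ℤ → FFPoly → FFPoly
mulLinear a p zero    = a ℤ.* p 0
mulLinear a p (suc j) = p j ℤ.+ (+ suc j ℤ.+ a) ℤ.* p (suc j)

prodLinear : List ℤ → FFPoly
prodLinear []       zero    = 1ℤ
prodLinear []       (suc j) = 0ℤ
prodLinear (a ∷ as) = mulLinear a (prodLinear as)

mulLinear-cong : ∀ a {p q} → p ≗ q → mulLinear a p ≗ mulLinear a q
mulLinear-cong a p≗q zero    = cong (a ℤ.*_) (p≗q 0)
mulLinear-cong a p≗q (suc j) = cong₂ (λ x y → x ℤ.+ (+ suc j ℤ.+ a) ℤ.* y) (p≗q j) (p≗q (suc j))

mulLinear-comm : ∀ a b p → mulLinear a (mulLinear b p) ≗ mulLinear b (mulLinear a p)
mulLinear-comm a b p zero          = swap₀ a b (p 0)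
  where swap₀ : ∀ a b x → a ℤ.* (b ℤ.* x) ≡ b ℤ.* (a ℤ.* x)
        swap₀ = ℤ.solve-∀
mulLinear-comm a b p (suc zero)    = swap₁ a b (p 0) (p 1)
  where swap₁ : ∀ a b x y → b ℤ.* x ℤ.+ (1ℤ ℤ.+ a) ℤ.* (x ℤ.+ (1ℤ ℤ.+ b) ℤ.* y)
                          ≡ a ℤ.* x ℤ.+ (1ℤ ℤ.+ b) ℤ.* (x ℤ.+ (1ℤ ℤ.+ a) ℤ.* y)
        swap₁ = ℤ.solve-∀
mulLinear-comm a b p (suc (suc j)) = swap₂ a b (+ suc j) (p j) (p (suc j)) (p (suc (suc j)))
  where swap₂ : ∀ a b n x y z → (x ℤ.+ (n ℤ.+ b) ℤ.* y) ℤ.+ ((1ℤ ℤ.+ n) ℤ.+ a) ℤ.* (y ℤ.+ ((1ℤ ℤ.+ n) ℤ.+ b) ℤ.* z)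
                              ≡ (x ℤ.+ (n ℤ.+ a) ℤ.* y) ℤ.+ ((1ℤ ℤ.+ n) ℤ.+ b) ℤ.* (y ℤ.+ ((1ℤ ℤ.+ n) ℤ.+ a) ℤ.* z)
        swap₂ = ℤ.solve-∀

↭⇒prodLinear-≗ : ∀ {as bs} → as ↭ bs → prodLinear as ≗ prodLinear bs
↭⇒prodLinear-≗ ↭.refl                    j = refl
↭⇒prodLinear-≗ (↭.prep a as↭bs)          = mulLinear-cong a (↭⇒prodLinear-≗ as↭bs)
↭⇒prodLinear-≗ (↭.swap {xs = as} a b as↭bs) j =
  trans (mulLinear-comm a b (prodLinear as) j) (mulLinear-cong b (mulLinear-cong a (↭⇒prodLinear-≗ as↭bs)) j)
↭⇒prodLinear-≗ (↭.trans as↭bs bs↭cs)     j = trans (↭⇒prodLinear-≗ as↭bs j) (↭⇒prodLinear-≗ bs↭cs j)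

DegreeBelow : ℕ → FFPoly → Set
DegreeBelow n p = ∀ j → n ≤ j → p j ≡ 0ℤ

prodLinear-degree : ∀ as → DegreeBelow (suc (length as)) (prodLinear as)
prodLinear-degree []       (suc j) _         = refl
prodLinear-degree (a ∷ as) (suc j) (s≤s n≤j) = begin
  prodLinear as j ℤ.+ (+ suc j ℤ.+ a) ℤ.* prodLinear as (suc j)
    ≡⟨ cong₂ (λ x y → x ℤ.+ (+ suc j ℤ.+ a) ℤ.* y)
             (prodLinear-degree as j n≤j) (prodLinear-degree as (suc j) (ℕ.m≤n⇒m≤1+n n≤j)) ⟩
  0ℤ ℤ.+ (+ suc j ℤ.+ a) ℤ.* 0ℤ
    ≡⟨ trans (ℤ.+-identityˡ _) (ℤ.*-zeroʳ (+ suc j ℤ.+ a)) ⟩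
  0ℤ ∎

prodLinear-leading : ∀ as → prodLinear as (length as) ≡ 1ℤ
prodLinear-leading []       = refl
prodLinear-leading (a ∷ as) = begin
  prodLinear as (length as) ℤ.+ (+ suc (length as) ℤ.+ a) ℤ.* prodLinear as (suc (length as))
    ≡⟨ cong₂ (λ x y → x ℤ.+ (+ suc (length as) ℤ.+ a) ℤ.* y)
             (prodLinear-leading as) (prodLinear-degree as (suc (length as)) ℕ.≤-refl) ⟩
  1ℤ ℤ.+ (+ suc (length as) ℤ.+ a) ℤ.* 0ℤ
    ≡⟨ cong ℤ.suc (ℤ.*-zeroʳ (+ suc (length as) ℤ.+ a)) ⟩
  1ℤ ∎

-- Compare coefficients from the top degree down.
mulLinear-cancel : ∀ n a {p q} → DegreeBelow n p → DegreeBelow n q → mulLinear a p ≗ mulLinear a q → p ≗ q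
mulLinear-cancel n a {p} {q} deg-p deg-q eq j = downward n j (ℕ.m≤m+n n j)
  where
  downward : ∀ d j → n ≤ d + j → p j ≡ q j
  downward zero    j n≤j = trans (deg-p j n≤j) (sym (deg-q j n≤j))
  downward (suc d) j n≤ = +-cancelʳ ((+ suc j ℤ.+ a) ℤ.* p (suc j)) (p j) (q j) (begin
    p j ℤ.+ (+ suc j ℤ.+ a) ℤ.* p (suc j) ≡⟨ eq (suc j) ⟩
    q j ℤ.+ (+ suc j ℤ.+ a) ℤ.* q (suc j) ≡⟨ cong (λ x → q j ℤ.+ (+ suc j ℤ.+ a) ℤ.* x) (downward d (suc j) n≤d+1+j) ⟨
    q j ℤ.+ (+ suc j ℤ.+ a) ℤ.* p (suc j) ∎)
    where n≤d+1+j = subst (n ≤_) (sym (ℕ.+-suc d j)) n≤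

-- The value at t, in the Horner form p₀ + t (p₁ + (t-1) (p₂ + ⋯)), of the part of p below degree n.
eval : ℕ → FFPoly → ℤ → ℤ
eval zero    p t = 0ℤ
eval (suc n) p t = p 0 ℤ.+ t ℤ.* eval n (p ∘ suc) (ℤ.pred t)

eval-cong : ∀ n {p q} → p ≗ q → ∀ t → eval n p t ≡ eval n q t
eval-cong zero    p≗q t = refl
eval-cong (suc n) p≗q t = cong₂ (λ x y → x ℤ.+ t ℤ.* y) (p≗q 0) (eval-cong n (p≗q ∘ suc) (ℤ.pred t))

mulLinear-shift : ∀ a p j → mulLinear a p (suc (suc j)) ≡ mulLinear (ℤ.suc a) (p ∘ suc) (suc j)
mulLinear-shift a p j = cong (λ c → p (suc j) ℤ.+ c ℤ.* p (suc (suc j))) (move (+ suc j) a)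
  where move : ∀ n a → (1ℤ ℤ.+ n) ℤ.+ a ≡ n ℤ.+ (1ℤ ℤ.+ a)
        move = ℤ.solve-∀

eval-mulLinear : ∀ n a p → DegreeBelow n p → ∀ t → eval (suc n) (mulLinear a p) t ≡ (t ℤ.+ a) ℤ.* eval n p t
eval-mulLinear zero    a p deg t = begin
  a ℤ.* p 0 ℤ.+ t ℤ.* 0ℤ     ≡⟨ cong (λ x → a ℤ.* x ℤ.+ t ℤ.* 0ℤ) (deg 0 z≤n) ⟩
  a ℤ.* 0ℤ ℤ.+ t ℤ.* 0ℤ      ≡⟨ vanish a t ⟩
  (t ℤ.+ a) ℤ.* 0ℤ           ∎
  where vanish : ∀ a t → a ℤ.* 0ℤ ℤ.+ t ℤ.* 0ℤ ≡ (t ℤ.+ a) ℤ.* 0ℤ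
        vanish = ℤ.solve-∀
eval-mulLinear (suc n) a p deg t = begin
  a ℤ.* p 0 ℤ.+ t ℤ.* eval (suc n) (mulLinear a p ∘ suc) s
    ≡⟨ cong (λ x → a ℤ.* p 0 ℤ.+ t ℤ.* x) split ⟩
  a ℤ.* p 0 ℤ.+ t ℤ.* (p 0 ℤ.+ eval (suc n) (mulLinear (ℤ.suc a) p′) s)
    ≡⟨ cong (λ x → a ℤ.* p 0 ℤ.+ t ℤ.* (p 0 ℤ.+ x)) (eval-mulLinear n (ℤ.suc a) p′ (λ j → deg (suc j) ∘ s≤s) s) ⟩
  a ℤ.* p 0 ℤ.+ t ℤ.* (p 0 ℤ.+ (s ℤ.+ ℤ.suc a) ℤ.* eval n p′ s)
    ≡⟨ horner a t (p 0) (eval n p′ s) ⟩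
  (t ℤ.+ a) ℤ.* (p 0 ℤ.+ t ℤ.* eval n p′ s) ∎
  where
  s  = ℤ.pred t
  p′ = p ∘ suc
  horner : ∀ a t x e → a ℤ.* x ℤ.+ t ℤ.* (x ℤ.+ ((-1ℤ ℤ.+ t) ℤ.+ (1ℤ ℤ.+ a)) ℤ.* e) ≡ (t ℤ.+ a) ℤ.* (x ℤ.+ t ℤ.* e)
  horner = ℤ.solve-∀
  split : eval (suc n) (mulLinear a p ∘ suc) s ≡ p 0 ℤ.+ eval (suc n) (mulLinear (ℤ.suc a) p′) s
  split = begin
    (p 0 ℤ.+ ℤ.suc a ℤ.* p 1) ℤ.+ s ℤ.* eval n (mulLinear a p ∘ suc ∘ suc) (ℤ.pred s)
      ≡⟨ cong (λ x → (p 0 ℤ.+ ℤ.suc a ℤ.* p 1) ℤ.+ s ℤ.* x) (eval-cong n (mulLinear-shift a p) (ℤ.pred s)) ⟩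
    (p 0 ℤ.+ ℤ.suc a ℤ.* p 1) ℤ.+ s ℤ.* eval n (mulLinear (ℤ.suc a) p′ ∘ suc) (ℤ.pred s)
      ≡⟨ ℤ.+-assoc (p 0) _ _ ⟩
    p 0 ℤ.+ eval (suc n) (mulLinear (ℤ.suc a) p′) s ∎

prodLinearAt : List ℤ → ℤ → ℤ
prodLinearAt []       t = 1ℤ
prodLinearAt (a ∷ as) t = (t ℤ.+ a) ℤ.* prodLinearAt as t

eval-prodLinear : ∀ as t → eval (suc (length as)) (prodLinear as) t ≡ prodLinearAt as t
eval-prodLinear []       t = trans (cong ℤ.suc (ℤ.*-zeroʳ t)) (ℤ.+-identityʳ 1ℤ)
eval-prodLinear (a ∷ as) t = begin
  eval (suc (suc (length as))) (mulLinear a (prodLinear as)) t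
    ≡⟨ eval-mulLinear (suc (length as)) a (prodLinear as) (prodLinear-degree as) t ⟩
  (t ℤ.+ a) ℤ.* eval (suc (length as)) (prodLinear as) t
    ≡⟨ cong ((t ℤ.+ a) ℤ.*_) (eval-prodLinear as t) ⟩
  (t ℤ.+ a) ℤ.* prodLinearAt as t ∎

prodLinearAt-root : ∀ as t → prodLinearAt as t ≡ 0ℤ → Any (λ a → t ℤ.+ a ≡ 0ℤ) as
prodLinearAt-root []       t ()
prodLinearAt-root (a ∷ as) t eq with ℤ.i*j≡0⇒i≡0∨j≡0 (t ℤ.+ a) eq
... | inj₁ root = here root
... | inj₂ rest = there (prodLinearAt-root as t rest)

prodLinear-root : ∀ a as bs → length bs ≡ suc (length as) → prodLinear (a ∷ as) ≗ prodLinear bs → a ∈ bs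
prodLinear-root a as bs len eq = Any.map (λ {b} → opposite b) (prodLinearAt-root bs (ℤ.- a) vanishes)
  where
  opposite : ∀ b → ℤ.- a ℤ.+ b ≡ 0ℤ → a ≡ b
  opposite b e = begin
    a                         ≡⟨ ℤ.+-identityʳ a ⟨
    a ℤ.+ 0ℤ                  ≡⟨ cong (λ x → a ℤ.+ x) e ⟨
    a ℤ.+ (ℤ.- a ℤ.+ b)        ≡⟨ cancel a b ⟩
    b                         ∎
    where cancel : ∀ a b → a ℤ.+ (ℤ.- a ℤ.+ b) ≡ b
          cancel = ℤ.solve-∀
  vanishes : prodLinearAt bs (ℤ.- a) ≡ 0ℤ
  vanishes = begin
    prodLinearAt bs (ℤ.- a)                                       ≡⟨ eval-prodLinear bs (ℤ.- a) ⟨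
    eval (suc (length bs)) (prodLinear bs) (ℤ.- a)                ≡⟨ cong (λ n → eval (suc n) (prodLinear bs) (ℤ.- a)) len ⟩
    eval (suc (suc (length as))) (prodLinear bs) (ℤ.- a)          ≡⟨ eval-cong (suc (suc (length as))) eq (ℤ.- a) ⟨
    eval (suc (suc (length as))) (prodLinear (a ∷ as)) (ℤ.- a)    ≡⟨ eval-prodLinear (a ∷ as) (ℤ.- a) ⟩
    (ℤ.- a ℤ.+ a) ℤ.* prodLinearAt as (ℤ.- a)                     ≡⟨ cong (ℤ._* prodLinearAt as (ℤ.- a)) (ℤ.+-inverseˡ a) ⟩
    0ℤ ℤ.* prodLinearAt as (ℤ.- a)                                ≡⟨ ℤ.*-zeroˡ (prodLinearAt as (ℤ.- a)) ⟩
    0ℤ                                                            ∎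

prodLinear-≗⇒length-≡ : ∀ as bs → prodLinear as ≗ prodLinear bs → length as ≡ length bs
prodLinear-≗⇒length-≡ as bs eq with ℕ.<-cmp (length as) (length bs)
... | tri< as<bs _ _ = contradiction (trans (sym (prodLinear-leading bs)) (trans (sym (eq (length bs))) (prodLinear-degree as (length bs) as<bs))) λ ()
... | tri≈ _ same _  = same
... | tri> _ _ bs<as = contradiction (trans (sym (prodLinear-leading as)) (trans (eq (length as)) (prodLinear-degree bs (length as) bs<as))) λ ()

prodLinear-injective : ∀ as bs → length as ≡ length bs → prodLinear as ≗ prodLinear bs → as ↭ bs
prodLinear-injective []       []       _   _  = ↭.refl
prodLinear-injective (a ∷ as) bs       len eq with ∈-∃++ (prodLinear-root a as bs (sym len) eq)
... | xs , ys , refl = ↭.trans (↭.prep a (prodLinear-injective as (xs ++ ys) len′ rest)) (↭.↭-sym (shift a xs ys))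
  where
  bs↭ : xs ++ a ∷ ys ↭ a ∷ xs ++ ys
  bs↭ = shift a xs ys
  len′ : length as ≡ length (xs ++ ys)
  len′ = ℕ.suc-injective (trans len (↭-length bs↭))
  rest : prodLinear as ≗ prodLinear (xs ++ ys)
  rest = mulLinear-cancel (suc (length as)) a (prodLinear-degree as)
           (subst (λ n → DegreeBelow (suc n) (prodLinear (xs ++ ys))) (sym len′) (prodLinear-degree (xs ++ ys)))
           (λ j → trans (eq j) (↭⇒prodLinear-≗ bs↭ j))

mult : List ℤ → ℤ → ℕ
mult xs x = length (filter (ℤ._≟ x) xs)

mult-∷-≡ : ∀ x xs → mult (x ∷ xs) x ≡ suc (mult xs x)
mult-∷-≡ x xs = cong length (filter-accept (ℤ._≟ x) refl)

mult-∷-≢ : ∀ {a x} xs → a ≢ x → mult (a ∷ xs) x ≡ mult xs x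
mult-∷-≢ {x = x} xs a≢x = cong length (filter-reject (ℤ._≟ x) a≢x)

mult-++ : ∀ xs ys x → mult (xs ++ ys) x ≡ mult xs x + mult ys x
mult-++ xs ys x = trans (cong length (filter-++ (ℤ._≟ x) xs ys)) (length-++ (filter (ℤ._≟ x) xs))

mult-map : ∀ {f : ℤ → ℤ} → Injective _≡_ _≡_ f → ∀ xs y → mult (map f xs) (f y) ≡ mult xs y
mult-map f-inj []       y = refl
mult-map {f} f-inj (a ∷ xs) y with a ℤ.≟ y
... | yes refl = trans (mult-∷-≡ (f a) (map f xs)) (cong suc (mult-map f-inj xs y))
... | no  a≢y  = trans (mult-∷-≢ (map f xs) (a≢y ∘ f-inj)) (mult-map f-inj xs y)

↭⇒mult-≗ : ∀ {xs ys} → xs ↭ ys → mult xs ≗ mult ys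
↭⇒mult-≗ xs↭ys x = ↭-length (filter-↭ (ℤ._≟ x) xs↭ys)

mult≡suc⇒∈ : ∀ xs {x n} → mult xs x ≡ suc n → x ∈ xs
mult≡suc⇒∈ (a ∷ xs) {x} eq with a ℤ.≟ x
... | yes refl = here refl
... | no  _    = there (mult≡suc⇒∈ xs eq)

∈⇒mult≢0 : ∀ {xs x} → x ∈ xs → mult xs x ≢ 0
∈⇒mult≢0 {xs} {x} x∈xs with filter (ℤ._≟ x) xs | ∈-filter⁺ (ℤ._≟ x) x∈xs refl
... | _ ∷ _ | _ = λ ()

mult-≗⇒↭ : ∀ xs ys → mult xs ≗ mult ys → xs ↭ ys
mult-≗⇒↭ []       []       _  = ↭.refl
mult-≗⇒↭ []       (b ∷ ys) eq = contradiction (trans (eq b) (mult-∷-≡ b ys)) ℕ.0≢1+n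
mult-≗⇒↭ (a ∷ xs) ys       eq with ∈-∃++ (mult≡suc⇒∈ ys (trans (sym (eq a)) (mult-∷-≡ a xs)))
... | l , r , refl = ↭.trans (↭.prep a (mult-≗⇒↭ xs (l ++ r) rest)) (↭.↭-sym (shift a l r))
  where
  rest : mult xs ≗ mult (l ++ r)
  rest x with a ℤ.≟ x
  ... | yes refl = ℕ.suc-injective (begin
    suc (mult xs a)      ≡⟨ mult-∷-≡ a xs ⟨
    mult (a ∷ xs) a      ≡⟨ eq a ⟩
    mult (l ++ a ∷ r) a  ≡⟨ ↭⇒mult-≗ (shift a l r) a ⟩
    mult (a ∷ l ++ r) a  ≡⟨ mult-∷-≡ a (l ++ r) ⟩
    suc (mult (l ++ r) a) ∎)
  ... | no a≢x = begin
    mult xs x            ≡⟨ mult-∷-≢ xs a≢x ⟨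
    mult (a ∷ xs) x      ≡⟨ eq x ⟩
    mult (l ++ a ∷ r) x  ≡⟨ ↭⇒mult-≗ (shift a l r) x ⟩
    mult (a ∷ l ++ r) x  ≡⟨ mult-∷-≢ (l ++ r) a≢x ⟩
    mult (l ++ r) x      ∎

mult-replicate-≡ : ∀ n a → mult (replicate n a) a ≡ n
mult-replicate-≡ zero    a = refl
mult-replicate-≡ (suc n) a = trans (mult-∷-≡ a (replicate n a)) (cong suc (mult-replicate-≡ n a))

mult-replicate-≢ : ∀ n {a x} → a ≢ x → mult (replicate n a) x ≡ 0
mult-replicate-≢ zero    a≢x = refl
mult-replicate-≢ (suc n) a≢x = trans (mult-∷-≢ (replicate n _) a≢x) (mult-replicate-≢ n a≢x)

-- A composition (c₀, c₁, …) into positive parts, stored as (c₀ - 1, c₁ - 1, …).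
Composition : Set
Composition = List ℕ

part : Composition → ℕ → ℕ
part []      _       = 0
part (e ∷ h) zero    = suc e
part (e ∷ h) (suc i) = part h i

weight : Composition → ℕ
weight []      = 0
weight (e ∷ h) = suc (e + weight h)

part-injective : ∀ h h′ → part h ≗ part h′ → h ≡ h′
part-injective []      []        _  = refl
part-injective []      (_ ∷ _)   eq = contradiction (eq 0) ℕ.0≢1+n
part-injective (_ ∷ _) []        eq = contradiction (sym (eq 0)) ℕ.0≢1+n
part-injective (e ∷ h) (e′ ∷ h′) eq = cong₂ _∷_ (ℕ.suc-injective (eq 0)) (part-injective h h′ (eq ∘ suc))

GapFree : (ℕ → ℕ) → Set
GapFree f = ∀ i → f i ≡ 0 → f (suc i) ≡ 0

readComposition : ℕ → (ℕ → ℕ) → Composition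
readComposition zero    f = []
readComposition (suc n) f with f 0
... | zero  = []
... | suc e = e ∷ readComposition n (f ∘ suc)

part-readComposition : ∀ n f → GapFree f → (∀ i → n ≤ i → f i ≡ 0) → part (readComposition n f) ≗ f
part-readComposition zero    f _       vanish i = sym (vanish i z≤n)
part-readComposition (suc n) f gapFree vanish i with f 0 in f0
... | zero  = sym (all-zero i)
  where all-zero : ∀ i → f i ≡ 0
        all-zero zero    = f0
        all-zero (suc i) = gapFree i (all-zero i)
... | suc e with i
...   | zero  = sym f0
...   | suc i = part-readComposition n (f ∘ suc) (gapFree ∘ suc) (λ i n≤i → vanish (suc i) (s≤s n≤i)) i

2*m≡m+m : ∀ k → 2 * k ≡ k + k
2*m≡m+m k = cong (k ℕ.+_) (+-identityʳ k)

enlarge : Composition → Composition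
enlarge []      = []
enlarge (e ∷ h) = suc e ∷ h

compositions : ℕ → List Composition
compositions zero          = [] ∷ []
compositions (suc zero)    = (0 ∷ []) ∷ []
compositions (suc (suc n)) = map (0 ∷_) (compositions (suc n)) ++ map enlarge (compositions (suc n))

compositions-weight : ∀ n → All (λ h → weight h ≡ n) (compositions n)
compositions-weight zero          = refl ∷ []
compositions-weight (suc zero)    = refl ∷ []
compositions-weight (suc (suc n)) =
  All.++⁺ (All.map⁺ (All.map (cong suc) (compositions-weight (suc n))))
          (All.map⁺ (All.map weight-enlarge (compositions-weight (suc n))))
  where weight-enlarge : ∀ {h} → weight h ≡ suc n → weight (enlarge h) ≡ suc (suc n)
        weight-enlarge {_ ∷ _} = cong suc

∈-compositions-∷ : ∀ e h → h ∈ compositions (weight h) → e ∷ h ∈ compositions (weight (e ∷ h))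
∈-compositions-∷ zero    []      _   = here refl
∈-compositions-∷ zero    (_ ∷ _) h∈  = ∈-++⁺ˡ (∈-map⁺ (0 ∷_) h∈)
∈-compositions-∷ (suc e) h       h∈  = ∈-++⁺ʳ (map (0 ∷_) _) (∈-map⁺ enlarge (∈-compositions-∷ e h h∈))

∈-compositions : ∀ h → h ∈ compositions (weight h)
∈-compositions []      = here refl
∈-compositions (e ∷ h) = ∈-compositions-∷ e h (∈-compositions h)

∈-compositions⇒weight : ∀ {h} n → h ∈ compositions n → weight h ≡ n
∈-compositions⇒weight n = All.lookup (compositions-weight n)

∈-compositions⇒≡ : ∀ {i i′ h} → h ∈ compositions i → h ∈ compositions i′ → i ≡ i′
∈-compositions⇒≡ {i} {i′} h∈ h∈′ = trans (sym (∈-compositions⇒weight i h∈)) (∈-compositions⇒weight i′ h∈′)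

compositions-unique : ∀ n → Unique (compositions n)
compositions-unique zero          = [] ∷ []
compositions-unique (suc zero)    = [] ∷ []
compositions-unique (suc (suc n)) =
  Unique.++⁺ (Unique.map⁺ ∷-injectiveʳ (compositions-unique (suc n)))
             (Unique.map⁺ enlarge-injective (compositions-unique (suc n)))
             starts-differently
  where
  enlarge-injective : ∀ {h h′} → enlarge h ≡ enlarge h′ → h ≡ h′
  enlarge-injective {[]}    {[]}    _    = refl
  enlarge-injective {_ ∷ _} {_ ∷ _} refl = refl
  starts-differently : Disjoint (map (0 ∷_) (compositions (suc n))) (map enlarge (compositions (suc n)))
  starts-differently (v∈ˡ , v∈ʳ) with ∈-map⁻ (0 ∷_) v∈ˡ | ∈-map⁻ enlarge v∈ʳ
  ... | _ , _ , refl | [] , _ , ()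
  ... | _ , _ , refl | _ ∷ _ , _ , ()

length-compositions : ∀ n → length (compositions (suc n)) ≡ 2 ^ n
length-compositions zero    = refl
length-compositions (suc n) = begin
  length (map (0 ∷_) cs ++ map enlarge cs)           ≡⟨ length-++ (map (0 ∷_) cs) ⟩
  length (map (0 ∷_) cs) + length (map enlarge cs)   ≡⟨ cong₂ _+_ (length-map (0 ∷_) cs) (length-map enlarge cs) ⟩
  length cs + length cs                              ≡⟨ cong (λ l → l + l) (length-compositions n) ⟩
  2 ^ n + 2 ^ n                                      ≡⟨ 2*m≡m+m (2 ^ n) ⟨
  2 ^ suc n                                          ∎
  where cs = compositions (suc n)

module _ {A B : Set} where

  pairs : (ℕ → List A) → (ℕ → List B) → ℕ → List (A × B)
  pairs E F zero    = cartesianProduct (E 0) (F 0)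
  pairs E F (suc n) = cartesianProduct (E 0) (F (suc n)) ++ pairs (E ∘ suc) F n

  ∈-pairs⁺ : ∀ {E F x y} i j → x ∈ E i → y ∈ F j → (x , y) ∈ pairs E F (i + j)
  ∈-pairs⁺         zero    zero    x∈ y∈ = ∈-cartesianProduct⁺ x∈ y∈
  ∈-pairs⁺         zero    (suc j) x∈ y∈ = ∈-++⁺ˡ (∈-cartesianProduct⁺ x∈ y∈)
  ∈-pairs⁺ {E} {F} (suc i) j       x∈ y∈ = ∈-++⁺ʳ (cartesianProduct (E 0) (F (suc (i + j)))) (∈-pairs⁺ {E ∘ suc} i j x∈ y∈)

  ∈-pairs⁻ : ∀ {E F} n {x y} → (x , y) ∈ pairs E F n → ∃₂ λ i j → i + j ≡ n × x ∈ E i × y ∈ F j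
  ∈-pairs⁻ {E} {F} zero    xy∈ = 0 , 0 , refl , ∈-cartesianProduct⁻ (E 0) (F 0) xy∈
  ∈-pairs⁻ {E} {F} (suc n) xy∈ with ∈-++⁻ (cartesianProduct (E 0) (F (suc n))) xy∈
  ... | inj₁ xy∈₀ = 0 , suc n , refl , ∈-cartesianProduct⁻ (E 0) (F (suc n)) xy∈₀
  ... | inj₂ xy∈₊ with ∈-pairs⁻ {E ∘ suc} n xy∈₊
  ...   | i , j , i+j≡n , x∈ , y∈ = suc i , j , cong suc i+j≡n , x∈ , y∈

  pairs-unique : ∀ {E F} → (∀ {i i′ x} → x ∈ E i → x ∈ E i′ → i ≡ i′) →
                 (∀ i → Unique (E i)) → (∀ j → Unique (F j)) → ∀ n → Unique (pairs E F n)
  pairs-unique         graded uE uF zero    = Unique.cartesianProduct⁺ (uE 0) (uF 0)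
  pairs-unique {E} {F} graded uE uF (suc n) =
    Unique.++⁺ (Unique.cartesianProduct⁺ (uE 0) (uF (suc n))) (pairs-unique {E ∘ suc} (λ p q → ℕ.suc-injective (graded p q)) (uE ∘ suc) uF n) separated
    where
    separated : Disjoint (cartesianProduct (E 0) (F (suc n))) (pairs (E ∘ suc) F n)
    separated {x , y} (xy∈₀ , xy∈₊) with ∈-pairs⁻ {E ∘ suc} n xy∈₊
    ... | _ , _ , _ , x∈ , _ = ℕ.0≢1+n (graded (proj₁ (∈-cartesianProduct⁻ (E 0) (F (suc n)) xy∈₀)) x∈)

length-cartesianProduct : ∀ {A B : Set} (xs : List A) (ys : List B) → length (cartesianProduct xs ys) ≡ length xs * length ys
length-cartesianProduct []       ys = refl
length-cartesianProduct (x ∷ xs) ys = begin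
  length (map (x ,_) ys ++ cartesianProduct xs ys)         ≡⟨ length-++ (map (x ,_) ys) ⟩
  length (map (x ,_) ys) + length (cartesianProduct xs ys) ≡⟨ cong₂ _+_ (length-map (x ,_) ys) (length-cartesianProduct xs ys) ⟩
  length ys + length xs * length ys                        ∎

convolution : (ℕ → ℕ) → (ℕ → ℕ) → ℕ → ℕ
convolution f g zero    = f 0 * g 0
convolution f g (suc n) = f 0 * g (suc n) + convolution (f ∘ suc) g n

length-pairs : ∀ {A B : Set} (E : ℕ → List A) (F : ℕ → List B) n → length (pairs E F n) ≡ convolution (length ∘ E) (length ∘ F) n
length-pairs E F zero    = length-cartesianProduct (E 0) (F 0)
length-pairs E F (suc n) = begin
  length (cartesianProduct (E 0) (F (suc n)) ++ pairs (E ∘ suc) F n)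
    ≡⟨ length-++ (cartesianProduct (E 0) (F (suc n))) ⟩
  length (cartesianProduct (E 0) (F (suc n))) + length (pairs (E ∘ suc) F n)
    ≡⟨ cong₂ _+_ (length-cartesianProduct (E 0) (F (suc n))) (length-pairs (E ∘ suc) F n) ⟩
  length (E 0) * length (F (suc n)) + convolution (length ∘ E ∘ suc) (length ∘ F) n ∎

convolution-cong : ∀ {f f′ g g′} → f ≗ f′ → g ≗ g′ → convolution f g ≗ convolution f′ g′
convolution-cong f≗ g≗ zero    = cong₂ _*_ (f≗ 0) (g≗ 0)
convolution-cong f≗ g≗ (suc n) = cong₂ _+_ (cong₂ _*_ (f≗ 0) (g≗ (suc n))) (convolution-cong (f≗ ∘ suc) g≗ n)

convolution-double : ∀ f g n → convolution (λ i → 2 * f i) g n ≡ 2 * convolution f g n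
convolution-double f g zero    = ℕ.*-assoc 2 (f 0) (g 0)
convolution-double f g (suc n) = begin
  2 * f 0 * g (suc n) + convolution (λ i → 2 * f (suc i)) g n ≡⟨ cong (2 * f 0 * g (suc n) ℕ.+_) (convolution-double (f ∘ suc) g n) ⟩
  2 * f 0 * g (suc n) + 2 * convolution (f ∘ suc) g n          ≡⟨ factor (f 0) (g (suc n)) (convolution (f ∘ suc) g n) ⟩
  2 * (f 0 * g (suc n) + convolution (f ∘ suc) g n)            ∎
  where factor : ∀ x y z → 2 * x * y + 2 * z ≡ 2 * (x * y + z)
        factor = solve-∀

-- Normal ordering in the Weyl algebra

termCoeff : Term → ℕ → ℕ → ℕ
termCoeff (c , i′ , j′) i j = if does (i′ ≟ i) ∧ does (j′ ≟ j) then c else 0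

coeff-∷ : ∀ t ts i j → coeff (t ∷ ts) i j ≡ termCoeff t i j + coeff ts i j
coeff-∷ (c , i′ , j′) ts i j with i′ ≟ i | j′ ≟ j
... | yes p | yes q rewrite dec-true (i′ ≟ i) p | dec-true (j′ ≟ j) q = refl
... | yes p | no ¬q rewrite dec-true (i′ ≟ i) p | dec-false (j′ ≟ j) ¬q = refl
... | no ¬p | _     rewrite dec-false (i′ ≟ i) ¬p = refl

coeff-++ : ∀ ts us i j → coeff (ts ++ us) i j ≡ coeff ts i j + coeff us i j
coeff-++ []       us i j = refl
coeff-++ (t ∷ ts) us i j = begin
  coeff (t ∷ ts ++ us) i j                          ≡⟨ coeff-∷ t (ts ++ us) i j ⟩
  termCoeff t i j + coeff (ts ++ us) i j            ≡⟨ cong (termCoeff t i j ℕ.+_) (coeff-++ ts us i j) ⟩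
  termCoeff t i j + (coeff ts i j + coeff us i j)   ≡⟨ +-assoc (termCoeff t i j) _ _ ⟨
  (termCoeff t i j + coeff ts i j) + coeff us i j   ≡⟨ cong (_+ coeff us i j) (coeff-∷ t ts i j) ⟨
  coeff (t ∷ ts) i j + coeff us i j                 ∎

coeff-map : ∀ (f : Term → Term) {i′ j′ i j} → (∀ t → termCoeff (f t) i′ j′ ≡ termCoeff t i j) →
            ∀ ts → coeff (map f ts) i′ j′ ≡ coeff ts i j
coeff-map f         same []       = refl
coeff-map f {i′} {j′} {i} {j} same (t ∷ ts) = begin
  coeff (f t ∷ map f ts) i′ j′                   ≡⟨ coeff-∷ (f t) (map f ts) i′ j′ ⟩
  termCoeff (f t) i′ j′ + coeff (map f ts) i′ j′ ≡⟨ cong₂ _+_ (same t) (coeff-map f same ts) ⟩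
  termCoeff t i j + coeff ts i j                 ≡⟨ coeff-∷ t ts i j ⟨
  coeff (t ∷ ts) i j                             ∎

coeff-map-0 : ∀ (f : Term → Term) {i j} → (∀ t → termCoeff (f t) i j ≡ 0) → ∀ ts → coeff (map f ts) i j ≡ 0
coeff-map-0 f         none []       = refl
coeff-map-0 f {i} {j} none (t ∷ ts) = begin
  coeff (f t ∷ map f ts) i j                 ≡⟨ coeff-∷ (f t) (map f ts) i j ⟩
  termCoeff (f t) i j + coeff (map f ts) i j ≡⟨ cong₂ _+_ (none t) (coeff-map-0 f none ts) ⟩
  0                                          ∎

raiseD : Term → Term
raiseD (c , i , j) = (c , i , suc j)

termCoeff-* : ∀ c i′ j′ i j → termCoeff (c * suc i′ , i′ , j′) i j ≡ suc i * termCoeff (c , i′ , j′) i j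
termCoeff-* c i′ j′ i j with i′ ≟ i
... | no ¬p rewrite dec-false (i′ ≟ i) ¬p = sym (*-zeroʳ (suc i))
... | yes refl rewrite dec-true (i′ ≟ i′) refl with does (j′ ≟ j)
...   | Data.Bool.true  = *-comm c (suc i′)
...   | Data.Bool.false = sym (*-zeroʳ (suc i′))

coeff-mulD : ∀ t i j → coeff (mulD t) i j ≡ termCoeff (raiseD t) i j + suc i * termCoeff t (suc i) j
coeff-mulD (c , zero , j′) i j =
  trans (coeff-∷ (c , 0 , suc j′) [] i j) (cong (termCoeff (c , 0 , suc j′) i j ℕ.+_) (sym (*-zeroʳ (suc i))))
coeff-mulD (c , suc i′ , j′) i j = begin
  coeff ((c , suc i′ , suc j′) ∷ (c * suc i′ , i′ , j′) ∷ []) i j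
    ≡⟨ coeff-∷ (c , suc i′ , suc j′) _ i j ⟩
  termCoeff (c , suc i′ , suc j′) i j + coeff ((c * suc i′ , i′ , j′) ∷ []) i j
    ≡⟨ cong (termCoeff (c , suc i′ , suc j′) i j ℕ.+_) (trans (coeff-∷ (c * suc i′ , i′ , j′) [] i j) (+-identityʳ _)) ⟩
  termCoeff (c , suc i′ , suc j′) i j + termCoeff (c * suc i′ , i′ , j′) i j
    ≡⟨ cong (termCoeff (c , suc i′ , suc j′) i j ℕ.+_) (termCoeff-* c i′ j′ i j) ⟩
  termCoeff (c , suc i′ , suc j′) i j + suc i * termCoeff (c , i′ , j′) i j ∎

coeff-concatMap-mulD : ∀ ts i j → coeff (concatMap mulD ts) i j ≡ coeff (map raiseD ts) i j + suc i * coeff ts (suc i) j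
coeff-concatMap-mulD []       i j = sym (*-zeroʳ (suc i))
coeff-concatMap-mulD (t ∷ ts) i j = begin
  coeff (mulD t ++ concatMap mulD ts) i j
    ≡⟨ coeff-++ (mulD t) (concatMap mulD ts) i j ⟩
  coeff (mulD t) i j + coeff (concatMap mulD ts) i j
    ≡⟨ cong₂ _+_ (coeff-mulD t i j) (coeff-concatMap-mulD ts i j) ⟩
  (r + suc i * x) + (rs + suc i * xs)
    ≡⟨ interchange r x rs xs (suc i) ⟩
  (r + rs) + suc i * (x + xs)
    ≡⟨ cong₂ (λ a b → a + suc i * b) (coeff-∷ (raiseD t) (map raiseD ts) i j) (coeff-∷ t ts (suc i) j) ⟨
  coeff (raiseD t ∷ map raiseD ts) i j + suc i * coeff (t ∷ ts) (suc i) j ∎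
  where
  r = termCoeff (raiseD t) i j
  rs = coeff (map raiseD ts) i j
  x = termCoeff t (suc i) j
  xs = coeff ts (suc i) j
  interchange : ∀ r x rs xs s → (r + s * x) + (rs + s * xs) ≡ (r + rs) + s * (x + xs)
  interchange = solve-∀

coeff-φ-U-zero : ∀ w j → coeff (φ (U ∷ w)) 0 j ≡ 0
coeff-φ-U-zero w j = coeff-map-0 mulU (λ _ → refl) (φ w)

coeff-φ-U-suc : ∀ w i j → coeff (φ (U ∷ w)) (suc i) j ≡ coeff (φ w) i j
coeff-φ-U-suc w i j = coeff-map mulU (λ _ → refl) (φ w)

coeff-φ-D-zero : ∀ w i → coeff (φ (D ∷ w)) i 0 ≡ suc i * coeff (φ w) (suc i) 0
coeff-φ-D-zero w i =
  trans (coeff-concatMap-mulD (φ w) i 0) (cong (_+ suc i * coeff (φ w) (suc i) 0) (coeff-map-0 raiseD no-D⁰ (φ w)))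
  where no-D⁰ : ∀ t → termCoeff (raiseD t) i 0 ≡ 0
        no-D⁰ (c , i′ , j′) = cong (λ b → if b then c else 0) (∧-zeroʳ (does (i′ ≟ i)))

coeff-φ-D-suc : ∀ w i j → coeff (φ (D ∷ w)) i (suc j) ≡ coeff (φ w) i j + suc i * coeff (φ w) (suc i) (suc j)
coeff-φ-D-suc w i j =
  trans (coeff-concatMap-mulD (φ w) i (suc j)) (cong (_+ suc i * coeff (φ w) (suc i) (suc j)) (coeff-map raiseD (λ _ → refl) (φ w)))

-- Heights and levels

height : Word → ℤ
height []      = 0ℤ
height (U ∷ w) = ℤ.suc (height w)
height (D ∷ w) = ℤ.pred (height w)

levels : Word → List ℤ
levels []      = []
levels (U ∷ w) = levels w
levels (D ∷ w) = height w ∷ levels w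

height-++ : ∀ u v → height (u ++ v) ≡ height u ℤ.+ height v
height-++ []      v = sym (ℤ.+-identityˡ (height v))
height-++ (U ∷ u) v = trans (cong ℤ.suc (height-++ u v)) (sym (ℤ.+-assoc 1ℤ (height u) (height v)))
height-++ (D ∷ u) v = trans (cong ℤ.pred (height-++ u v)) (sym (ℤ.+-assoc -1ℤ (height u) (height v)))

levels-++ : ∀ u v → levels (u ++ v) ≡ map (ℤ._+ height v) (levels u) ++ levels v
levels-++ []      v = refl
levels-++ (U ∷ u) v = levels-++ u v
levels-++ (D ∷ u) v = cong₂ _∷_ (height-++ u v) (levels-++ u v)

length-levels : ∀ w → length (levels w) ≡ countD w
length-levels []      = refl
length-levels (U ∷ w) = length-levels w
length-levels (D ∷ w) = cong suc (length-levels w)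

height-length : ∀ w → height w ℤ.+ (+ countD w ℤ.+ + countD w) ≡ + length w
height-length []      = refl
height-length (U ∷ w) = trans (ℤ.+-assoc 1ℤ (height w) _) (cong ℤ.suc (height-length w))
height-length (D ∷ w) = trans (regroup (height w) (+ countD w)) (cong ℤ.suc (height-length w))
  where regroup : ∀ h d → (-1ℤ ℤ.+ h) ℤ.+ ((1ℤ ℤ.+ d) ℤ.+ (1ℤ ℤ.+ d)) ≡ 1ℤ ℤ.+ (h ℤ.+ (d ℤ.+ d))
        regroup = ℤ.solve-∀

height⇒length : ∀ w {m} → height w ≡ + m → length w ≡ m + (countD w + countD w)
height⇒length w {m} h≡m = ℤ.+-injective (trans (sym (height-length w)) (cong (ℤ._+ + (countD w + countD w)) h≡m))

countD-++ : ∀ u v → countD (u ++ v) ≡ countD u + countD v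
countD-++ []      v = refl
countD-++ (U ∷ u) v = countD-++ u v
countD-++ (D ∷ u) v = cong suc (countD-++ u v)

mult-levels-++ : ∀ u v x → mult (levels (u ++ v)) x ≡ mult (levels u) (x ℤ.- height v) + mult (levels v) x
mult-levels-++ u v x = begin
  mult (levels (u ++ v)) x                                           ≡⟨ cong (λ l → mult l x) (levels-++ u v) ⟩
  mult (map (ℤ._+ h) (levels u) ++ levels v) x                       ≡⟨ mult-++ (map (ℤ._+ h) (levels u)) (levels v) x ⟩
  mult (map (ℤ._+ h) (levels u)) x + mult (levels v) x
    ≡⟨ cong (λ y → mult (map (ℤ._+ h) (levels u)) y + mult (levels v) x) (minus-plus x h) ⟩
  mult (map (ℤ._+ h) (levels u)) ((x ℤ.- h) ℤ.+ h) + mult (levels v) x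
    ≡⟨ cong (_+ mult (levels v) x) (mult-map (+-cancelʳ h _ _) (levels u) (x ℤ.- h)) ⟩
  mult (levels u) (x ℤ.- h) + mult (levels v) x                      ∎
  where h = height v
        minus-plus : ∀ x h → x ≡ (x ℤ.- h) ℤ.+ h
        minus-plus = ℤ.solve-∀

mult-levels-++-height0 : ∀ u v → height v ≡ 0ℤ → ∀ x → mult (levels (u ++ v)) x ≡ mult (levels u) x + mult (levels v) x
mult-levels-++-height0 u v flat x = begin
  mult (levels (u ++ v)) x                                 ≡⟨ mult-levels-++ u v x ⟩
  mult (levels u) (x ℤ.- height v) + mult (levels v) x     ≡⟨ cong (λ h → mult (levels u) (x ℤ.- h) + mult (levels v) x) flat ⟩
  mult (levels u) (x ℤ.+ 0ℤ) + mult (levels v) x           ≡⟨ cong (λ y → mult (levels u) y + mult (levels v) x) (ℤ.+-identityʳ x) ⟩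
  mult (levels u) x + mult (levels v) x                    ∎

private
  U-diagonal : ∀ {i} x h → + suc i ≡ x ℤ.+ ℤ.suc h → + i ≡ x ℤ.+ h
  U-diagonal x h e = suc-injective (trans e (+-sucʳ x h))

  U-diagonal⁻¹ : ∀ {i} x h → + i ≡ x ℤ.+ h → + suc i ≡ x ℤ.+ ℤ.suc h
  U-diagonal⁻¹ x h e = trans (cong ℤ.suc e) (sym (+-sucʳ x h))

  D-diagonal : ∀ {i} x h → + i ≡ x ℤ.+ ℤ.pred h → + suc i ≡ x ℤ.+ h
  D-diagonal x h e = sym (pred-transpose (sym (trans e (ℤ.+-pred x h))))

  D-diagonal⁻¹ : ∀ {i} x h → + suc i ≡ x ℤ.+ h → + i ≡ x ℤ.+ ℤ.pred h
  D-diagonal⁻¹ x h e = trans (suc-transpose e) (sym (ℤ.+-pred x h))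

  ≤0-*-vanishes : ∀ {c x} m → c ≡ ℤ.- (+ m) → (∀ {m′} → c ≡ -[1+ m′ ] → x ≡ 0ℤ) → c ℤ.* x ≡ 0ℤ
  ≤0-*-vanishes {x = x} zero    refl _  = ℤ.*-zeroˡ x
  ≤0-*-vanishes {c}     (suc m) c≡  x≡0 = trans (cong (c ℤ.*_) (x≡0 c≡)) (ℤ.*-zeroʳ c)

-- The coefficients that would belong to a negative power of U vanish.
prodLinear-levels-vanishes : ∀ w j {m} → + j ℤ.+ height w ≡ -[1+ m ] → prodLinear (levels w) j ≡ 0ℤ
prodLinear-levels-vanishes []      j       ()
prodLinear-levels-vanishes (U ∷ w) j       e =
  prodLinear-levels-vanishes w j (suc-transpose (trans (sym (+-sucʳ (+ j) (height w))) e))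
prodLinear-levels-vanishes (D ∷ w) zero    {m} e =
  ≤0-*-vanishes {height w} m (trans (pred-transpose (trans (sym (ℤ.+-identityˡ _)) e)) (ℤ.1-[1+n]≡-n m))
    (λ e′ → prodLinear-levels-vanishes w 0 (trans (ℤ.+-identityˡ (height w)) e′))
prodLinear-levels-vanishes (D ∷ w) (suc j) {m} e =
  cong₂ ℤ._+_ (prodLinear-levels-vanishes w j e′) (≤0-*-vanishes m c≡-m (prodLinear-levels-vanishes w (suc j)))
  where e′ : + j ℤ.+ height w ≡ -[1+ m ]
        e′ = trans (sym (suc-+-pred (+ j) (height w))) e
        c≡-m : + suc j ℤ.+ height w ≡ ℤ.- (+ m)
        c≡-m = trans (ℤ.suc-+ j (height w)) (trans (cong ℤ.suc e′) (ℤ.1-[1+n]≡-n m))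

coeff-φ-diagonal : ∀ w i j → + i ≡ + j ℤ.+ height w → + coeff (φ w) i j ≡ prodLinear (levels w) j
coeff-φ-diagonal []      zero    zero    _ = refl
coeff-φ-diagonal []      (suc i) (suc j) _ = refl
coeff-φ-diagonal []      zero    (suc j) ()
coeff-φ-diagonal []      (suc i) zero    ()
coeff-φ-diagonal (U ∷ w) zero    j e = begin
  + coeff (φ (U ∷ w)) 0 j     ≡⟨ cong +_ (coeff-φ-U-zero w j) ⟩
  0ℤ                          ≡⟨ prodLinear-levels-vanishes w j below ⟨
  prodLinear (levels w) j     ∎
  where below : + j ℤ.+ height w ≡ -[1+ 0 ]
        below = suc-transpose (trans (sym (+-sucʳ (+ j) (height w))) (sym e))
coeff-φ-diagonal (U ∷ w) (suc i) j e =
  trans (cong +_ (coeff-φ-U-suc w i j)) (coeff-φ-diagonal w i j (U-diagonal (+ j) (height w) e))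
coeff-φ-diagonal (D ∷ w) i zero e = begin
  + coeff (φ (D ∷ w)) i 0                        ≡⟨ cong +_ (coeff-φ-D-zero w i) ⟩
  + (suc i * coeff (φ w) (suc i) 0)              ≡⟨ ℤ.pos-* (suc i) _ ⟩
  + suc i ℤ.* + coeff (φ w) (suc i) 0
    ≡⟨ cong₂ ℤ._*_ (trans diag (ℤ.+-identityˡ (height w))) (coeff-φ-diagonal w (suc i) 0 diag) ⟩
  height w ℤ.* prodLinear (levels w) 0           ∎
  where diag : + suc i ≡ + 0 ℤ.+ height w
        diag = D-diagonal (+ 0) (height w) e
coeff-φ-diagonal (D ∷ w) i (suc j) e = begin
  + coeff (φ (D ∷ w)) i (suc j)     ≡⟨ cong +_ (coeff-φ-D-suc w i j) ⟩
  + (a + suc i * b)                 ≡⟨ ℤ.pos-+ a (suc i * b) ⟩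
  + a ℤ.+ + (suc i * b)             ≡⟨ cong (λ x → + a ℤ.+ x) (ℤ.pos-* (suc i) b) ⟩
  + a ℤ.+ + suc i ℤ.* + b           ≡⟨ cong₂ ℤ._+_ (coeff-φ-diagonal w i j diag)
                                                   (cong₂ ℤ._*_ diag′ (coeff-φ-diagonal w (suc i) (suc j) diag′)) ⟩
  prodLinear (levels w) j ℤ.+ (+ suc j ℤ.+ height w) ℤ.* prodLinear (levels w) (suc j) ∎
  where a = coeff (φ w) i j
        b = coeff (φ w) (suc i) (suc j)
        diag′ : + suc i ≡ + suc j ℤ.+ height w
        diag′ = D-diagonal (+ suc j) (height w) e
        diag : + i ≡ + j ℤ.+ height w
        diag = suc-injective (trans diag′ (ℤ.suc-+ j (height w)))

coeff-φ-off-diagonal : ∀ w i j → + i ≢ + j ℤ.+ height w → coeff (φ w) i j ≡ 0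
coeff-φ-off-diagonal []      zero    zero    ne = contradiction refl ne
coeff-φ-off-diagonal []      zero    (suc j) _  = refl
coeff-φ-off-diagonal []      (suc i) j       _  = refl
coeff-φ-off-diagonal (U ∷ w) zero    j       _  = coeff-φ-U-zero w j
coeff-φ-off-diagonal (U ∷ w) (suc i) j       ne =
  trans (coeff-φ-U-suc w i j) (coeff-φ-off-diagonal w i j (ne ∘ U-diagonal⁻¹ (+ j) (height w)))
coeff-φ-off-diagonal (D ∷ w) i zero ne = begin
  coeff (φ (D ∷ w)) i 0               ≡⟨ coeff-φ-D-zero w i ⟩
  suc i * coeff (φ w) (suc i) 0       ≡⟨ cong (suc i *_) (coeff-φ-off-diagonal w (suc i) 0 (ne ∘ D-diagonal⁻¹ (+ 0) (height w))) ⟩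
  suc i * 0                           ≡⟨ *-zeroʳ (suc i) ⟩
  0                                   ∎
coeff-φ-off-diagonal (D ∷ w) i (suc j) ne = begin
  coeff (φ (D ∷ w)) i (suc j)                                   ≡⟨ coeff-φ-D-suc w i j ⟩
  coeff (φ w) i j + suc i * coeff (φ w) (suc i) (suc j)
    ≡⟨ cong₂ (λ a b → a + suc i * b) (coeff-φ-off-diagonal w i j (ne ∘ D-diagonal⁻¹ (+ suc j) (height w) ∘ suc-diagonal))
                                     (coeff-φ-off-diagonal w (suc i) (suc j) (ne ∘ D-diagonal⁻¹ (+ suc j) (height w))) ⟩
  0 + suc i * 0                                                 ≡⟨ *-zeroʳ (suc i) ⟩
  0                                                             ∎
  where suc-diagonal : + i ≡ + j ℤ.+ height w → + suc i ≡ + suc j ℤ.+ height w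
        suc-diagonal e = trans (cong ℤ.suc e) (sym (ℤ.suc-+ j (height w)))

WeylEquiv⇒prodLinear-≗ : ∀ u v → height u ≡ height v → WeylEquiv u v → prodLinear (levels u) ≗ prodLinear (levels v)
WeylEquiv⇒prodLinear-≗ u v same-height u∼v j with + j ℤ.+ height u in e
... | + i = begin
  prodLinear (levels u) j   ≡⟨ coeff-φ-diagonal u i j (sym e) ⟨
  + coeff (φ u) i j         ≡⟨ cong +_ (u∼v i j) ⟩
  + coeff (φ v) i j         ≡⟨ coeff-φ-diagonal v i j (trans (sym e) (cong (λ h → + j ℤ.+ h) same-height)) ⟩
  prodLinear (levels v) j   ∎
... | -[1+ m ] = trans (prodLinear-levels-vanishes u j e)
                       (sym (prodLinear-levels-vanishes v j (trans (cong (λ h → + j ℤ.+ h) (sym same-height)) e)))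

prodLinear-≗⇒WeylEquiv : ∀ u v → height u ≡ height v → prodLinear (levels u) ≗ prodLinear (levels v) → WeylEquiv u v
prodLinear-≗⇒WeylEquiv u v same-height eq i j with + i ℤ.≟ + j ℤ.+ height u
... | yes on-u = ℤ.+-injective (begin
  + coeff (φ u) i j          ≡⟨ coeff-φ-diagonal u i j on-u ⟩
  prodLinear (levels u) j    ≡⟨ eq j ⟩
  prodLinear (levels v) j    ≡⟨ coeff-φ-diagonal v i j on-v ⟨
  + coeff (φ v) i j          ∎)
  where on-v = trans on-u (cong (λ h → + j ℤ.+ h) same-height)
... | no off-u = trans (coeff-φ-off-diagonal u i j off-u)
                       (sym (coeff-φ-off-diagonal v i j (off-u ∘ λ on-v → trans on-v (cong (λ h → + j ℤ.+ h) (sym same-height)))))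

WeylEquiv⇔levels-↭ : ∀ u v → height u ≡ height v → WeylEquiv u v ⇔ (levels u ↭ levels v)
WeylEquiv⇔levels-↭ u v same-height = mk⇔
  (λ u∼v → let eq = WeylEquiv⇒prodLinear-≗ u v same-height u∼v in
           prodLinear-injective (levels u) (levels v) (prodLinear-≗⇒length-≡ (levels u) (levels v) eq) eq)
  (prodLinear-≗⇒WeylEquiv u v same-height ∘ ↭⇒prodLinear-≗)

-- The shape of the levels

levels-of-negative-height : ∀ w {d i} → height w ≡ -[1+ d ] → i ≤ d → ℤ.- (+ i) ∈ levels w
levels-of-negative-height []      ()
levels-of-negative-height (U ∷ w) e i≤d = levels-of-negative-height w (suc-transpose e) (ℕ.m≤n⇒m≤1+n i≤d)
levels-of-negative-height (D ∷ w) {d} e i≤d with ℕ.m≤n⇒m<n∨m≡n i≤d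
... | inj₂ refl = here (sym (trans (pred-transpose e) (ℤ.1-[1+n]≡-n d)))
levels-of-negative-height (D ∷ w) {suc d} e _ | inj₁ (s≤s i≤d) =
  there (levels-of-negative-height w (pred-transpose e) i≤d)

-- To get below a level, the walk read from the right has to step down from it.
levels-gapless-below-0 : ∀ w {n} → -[1+ n ] ∈ levels w → ℤ.- (+ n) ∈ levels w
levels-gapless-below-0 (U ∷ w) p         = levels-gapless-below-0 w p
levels-gapless-below-0 (D ∷ w) (here e)  = there (levels-of-negative-height w (sym e) ℕ.≤-refl)
levels-gapless-below-0 (D ∷ w) (there p) = there (levels-gapless-below-0 w p)

-- From a level above its final height, the walk read from the right has to come back down.
levels-gapless-above : ∀ w {n} → height w ℤ.+ + suc (suc n) ∈ levels w → height w ℤ.+ + suc n ∈ levels w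
levels-gapless-above (U ∷ w) {n} p =
  subst (_∈ levels w) (sym (suc-+≡+-suc (height w) (+ suc n)))
        (levels-gapless-above w (subst (_∈ levels w) (suc-+≡+-suc (height w) (+ suc (suc n))) p))
levels-gapless-above (D ∷ w) {zero}  _ = here (trans (pred-+-suc (height w) (+ 0)) (ℤ.+-identityʳ (height w)))
levels-gapless-above (D ∷ w) {suc n} (here e) =
  contradiction (+-cancelˡ (height w) (+ suc (suc n)) 0ℤ h+2+n≡h+0) λ ()
  where h+2+n≡h+0 = trans (sym (pred-+-suc (height w) (+ suc (suc n)))) (trans e (sym (ℤ.+-identityʳ (height w))))
levels-gapless-above (D ∷ w) {suc n} (there p) =
  there (subst (_∈ levels w) (sym (pred-+-suc (height w) (+ suc n)))
               (levels-gapless-above w (subst (_∈ levels w) (pred-+-suc (height w) (+ suc (suc n))) p)))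

∣height∣≤length : ∀ w → ℤ.∣ height w ∣ ≤ length w
∣height∣≤length []      = z≤n
∣height∣≤length (U ∷ w) = ℕ.≤-trans (ℤ.∣i+j∣≤∣i∣+∣j∣ 1ℤ (height w)) (s≤s (∣height∣≤length w))
∣height∣≤length (D ∷ w) = ℕ.≤-trans (ℤ.∣i+j∣≤∣i∣+∣j∣ -1ℤ (height w)) (s≤s (∣height∣≤length w))

levels-bounded : ∀ w {x} → x ∈ levels w → ℤ.∣ x ∣ < length w
levels-bounded (U ∷ w) p         = ℕ.m<n⇒m<1+n (levels-bounded w p)
levels-bounded (D ∷ w) (here refl) = s≤s (∣height∣≤length w)
levels-bounded (D ∷ w) (there p) = ℕ.m<n⇒m<1+n (levels-bounded w p)

mult-gapFree : ∀ xs (g : ℕ → ℤ) → (∀ {i} → g (suc i) ∈ xs → g i ∈ xs) → GapFree (mult xs ∘ g)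
mult-gapFree xs g step i none with mult xs (g (suc i)) in e
... | zero  = refl
... | suc _ = contradiction none (∈⇒mult≢0 (step (mult≡suc⇒∈ xs e)))

mult-levels-beyond : ∀ w {x} → length w ≤ ℤ.∣ x ∣ → mult (levels w) x ≡ 0
mult-levels-beyond w {x} long with mult (levels w) x in e
... | zero  = refl
... | suc _ = contradiction (levels-bounded w (mult≡suc⇒∈ (levels w) e)) (ℕ.≤⇒≯ long)

multBelow multAbove : Word → ℕ → ℕ
multBelow w i = mult (levels w) (ℤ.- (+ i))
multAbove w i = mult (levels w) (+ suc i)

mult-levels-≗ : ∀ u v → multBelow u ≗ multBelow v → multAbove u ≗ multAbove v → mult (levels u) ≗ mult (levels v)
mult-levels-≗ u v below above (+ zero)  = below 0
mult-levels-≗ u v below above (+ suc n) = above n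
mult-levels-≗ u v below above -[1+ n ]  = below (suc n)

multBelow-gapFree : ∀ w → GapFree (multBelow w)
multBelow-gapFree w = mult-gapFree (levels w) (λ i → ℤ.- (+ i)) (levels-gapless-below-0 w)

multAbove-gapFree : ∀ w {m} → height w ≡ + m → GapFree (λ i → mult (levels w) (+ (m + suc i)))
multAbove-gapFree w {m} h≡m = mult-gapFree (levels w) (λ i → + (m + suc i))
  (subst (λ h → ∀ {i} → h ℤ.+ + suc (suc i) ∈ levels w → h ℤ.+ + suc i ∈ levels w) h≡m (levels-gapless-above w))

multBelow-beyond : ∀ w i → length w ≤ i → multBelow w i ≡ 0
multBelow-beyond w i long = mult-levels-beyond w (subst (length w ≤_) (sym (ℤ.∣-i∣≡∣i∣ (+ i))) long)

multAbove-beyond : ∀ w m i → length w ≤ i → mult (levels w) (+ (m + suc i)) ≡ 0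
multAbove-beyond w m i long = mult-levels-beyond w (ℕ.≤-trans long (ℕ.≤-trans (ℕ.n≤1+n i) (ℕ.m≤n+m (suc i) m)))

-- The length of a word bounds the absolute values of its levels, so it suffices as the fuel of readComposition.
readBelow : Word → Composition
readBelow w = readComposition (length w) (multBelow w)

readAbove : ℕ → Word → Composition
readAbove m w = readComposition (length w) (λ i → mult (levels w) (+ (m + suc i)))

part-readBelow : ∀ w → part (readBelow w) ≗ multBelow w
part-readBelow w = part-readComposition (length w) (multBelow w) (multBelow-gapFree w) (multBelow-beyond w)

part-readAbove : ∀ w {m} → height w ≡ + m → part (readAbove m w) ≗ (λ i → mult (levels w) (+ (m + suc i)))
part-readAbove w {m} h≡m = part-readComposition (length w) _ (multAbove-gapFree w h≡m) (multAbove-beyond w m)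

-- Canonical words

UD^_·_ : ℕ → Word → Word
UD^ zero  · w = w
UD^ suc n · w = U ∷ D ∷ UD^ n · w

height-UD^ : ∀ n w → height (UD^ n · w) ≡ height w
height-UD^ zero    w = refl
height-UD^ (suc n) w = trans (cong (ℤ.suc ∘ ℤ.pred) (height-UD^ n w)) (ℤ.suc-pred (height w))

levels-UD^ : ∀ n w → levels (UD^ n · w) ≡ replicate n (height w) ++ levels w
levels-UD^ zero    w = refl
levels-UD^ (suc n) w = cong₂ _∷_ (height-UD^ n w) (levels-UD^ n w)

mult-levels-UD^ : ∀ n w x → mult (levels (UD^ n · w)) x ≡ mult (replicate n (height w)) x + mult (levels w) x
mult-levels-UD^ n w x = trans (cong (λ l → mult l x) (levels-UD^ n w)) (mult-++ (replicate n (height w)) (levels w) x)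

countD-UD^ : ∀ n w → countD (UD^ n · w) ≡ n + countD w
countD-UD^ zero    w = refl
countD-UD^ (suc n) w = cong suc (countD-UD^ n w)

-- Words of height 0 whose levels 0, -1, -2, … resp. 1, 2, 3, … occur as often as the parts of h say.
below : Composition → Word
below []      = []
below (e ∷ h) = U ∷ below h ++ D ∷ UD^ e · []

above : Composition → Word
above []      = []
above (e ∷ h) = D ∷ UD^ e · (above h ++ U ∷ [])

height-below : ∀ h → height (below h) ≡ 0ℤ
height-below []      = refl
height-below (e ∷ h) = begin
  ℤ.suc (height (below h ++ D ∷ UD^ e · []))
    ≡⟨ cong ℤ.suc (height-++ (below h) (D ∷ UD^ e · [])) ⟩
  ℤ.suc (height (below h) ℤ.+ ℤ.pred (height (UD^ e · [])))
    ≡⟨ cong₂ (λ a b → ℤ.suc (a ℤ.+ ℤ.pred b)) (height-below h) (height-UD^ e []) ⟩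
  0ℤ ∎

height-above-U : ∀ h → height (above h ++ U ∷ []) ≡ 1ℤ
height-above : ∀ h → height (above h) ≡ 0ℤ

height-above-U h = trans (height-++ (above h) (U ∷ [])) (cong (ℤ._+ 1ℤ) (height-above h))

height-above []      = refl
height-above (e ∷ h) = cong ℤ.pred (trans (height-UD^ e (above h ++ U ∷ [])) (height-above-U h))

countD-below : ∀ h → countD (below h) ≡ weight h
countD-below []      = refl
countD-below (e ∷ h) = begin
  countD (below h ++ D ∷ UD^ e · [])   ≡⟨ countD-++ (below h) (D ∷ UD^ e · []) ⟩
  countD (below h) + suc (countD (UD^ e · []))
    ≡⟨ cong₂ (λ a b → a + suc b) (countD-below h) (trans (countD-UD^ e []) (+-identityʳ e)) ⟩
  weight h + suc e                     ≡⟨ ℕ.+-comm (weight h) (suc e) ⟩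
  suc (e + weight h)                   ∎

countD-above : ∀ h → countD (above h) ≡ weight h
countD-above []      = refl
countD-above (e ∷ h) = cong suc (begin
  countD (UD^ e · (above h ++ U ∷ []))   ≡⟨ countD-UD^ e (above h ++ U ∷ []) ⟩
  e + countD (above h ++ U ∷ [])         ≡⟨ cong (e ℕ.+_) (trans (countD-++ (above h) (U ∷ [])) (+-identityʳ _)) ⟩
  e + countD (above h)                   ≡⟨ cong (e ℕ.+_) (countD-above h) ⟩
  e + weight h                           ∎)

mult-levels-below-∷ : ∀ e h x → mult (levels (below (e ∷ h))) x ≡ mult (levels (below h)) (x ℤ.+ 1ℤ) + mult (replicate (suc e) 0ℤ) x
mult-levels-below-∷ e h x = begin
  mult (levels (below h ++ D ∷ UD^ e · [])) x
    ≡⟨ mult-levels-++ (below h) (D ∷ UD^ e · []) x ⟩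
  mult (levels (below h)) (x ℤ.- ℤ.pred (height (UD^ e · []))) + mult (levels (D ∷ UD^ e · [])) x
    ≡⟨ cong₂ (λ c l → mult (levels (below h)) (x ℤ.- ℤ.pred c) + mult l x) (height-UD^ e []) levels-D ⟩
  mult (levels (below h)) (x ℤ.+ 1ℤ) + mult (replicate (suc e) 0ℤ) x ∎
  where levels-D : levels (D ∷ UD^ e · []) ≡ replicate (suc e) 0ℤ
        levels-D = cong₂ _∷_ (height-UD^ e []) (trans (levels-UD^ e []) (++-identityʳ (replicate e 0ℤ)))

mult-levels-above-∷ : ∀ e h x → mult (levels (above (e ∷ h))) x ≡ mult (replicate (suc e) 1ℤ) x + mult (levels (above h)) (x ℤ.- 1ℤ)
mult-levels-above-∷ e h x = begin
  mult (levels (above (e ∷ h))) x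
    ≡⟨ cong (λ l → mult l x) (cong₂ _∷_ (height-UD^ e r) (levels-UD^ e r)) ⟩
  mult (replicate (suc e) (height r) ++ levels r) x
    ≡⟨ mult-++ (replicate (suc e) (height r)) (levels r) x ⟩
  mult (replicate (suc e) (height r)) x + mult (levels r) x
    ≡⟨ cong₂ (λ c m → mult (replicate (suc e) c) x + m) (height-above-U h) (mult-levels-++ (above h) (U ∷ []) x) ⟩
  mult (replicate (suc e) 1ℤ) x + (mult (levels (above h)) (x ℤ.- 1ℤ) + 0)
    ≡⟨ cong (mult (replicate (suc e) 1ℤ) x ℕ.+_) (+-identityʳ _) ⟩
  mult (replicate (suc e) 1ℤ) x + mult (levels (above h)) (x ℤ.- 1ℤ) ∎
  where r = above h ++ U ∷ []

multAbove-below : ∀ h i → multAbove (below h) i ≡ 0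
multAbove-below []      i = refl
multAbove-below (e ∷ h) i = begin
  multAbove (below (e ∷ h)) i
    ≡⟨ mult-levels-below-∷ e h (+ suc i) ⟩
  mult (levels (below h)) (+ suc i ℤ.+ 1ℤ) + mult (replicate (suc e) 0ℤ) (+ suc i)
    ≡⟨ cong₂ _+_ (cong (mult (levels (below h)) ∘ +_ ∘ suc) (ℕ.+-comm i 1)) (mult-replicate-≢ (suc e) {0ℤ} {+ suc i} λ ()) ⟩
  multAbove (below h) (suc i) + 0
    ≡⟨ cong (_+ 0) (multAbove-below h (suc i)) ⟩
  0 ∎

multBelow-below : ∀ h → multBelow (below h) ≗ part h
multBelow-below []      i       = refl
multBelow-below (e ∷ h) zero    = begin
  multBelow (below (e ∷ h)) 0                             ≡⟨ mult-levels-below-∷ e h 0ℤ ⟩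
  multAbove (below h) 0 + mult (replicate (suc e) 0ℤ) 0ℤ  ≡⟨ cong₂ _+_ (multAbove-below h 0) (mult-replicate-≡ (suc e) 0ℤ) ⟩
  suc e                                                   ∎
multBelow-below (e ∷ h) (suc i) = begin
  multBelow (below (e ∷ h)) (suc i)
    ≡⟨ mult-levels-below-∷ e h -[1+ i ] ⟩
  mult (levels (below h)) (ℤ.- (+ suc i) ℤ.+ 1ℤ) + mult (replicate (suc e) 0ℤ) -[1+ i ]
    ≡⟨ cong₂ _+_ (cong (mult (levels (below h))) (-suc+1 (+ i))) (mult-replicate-≢ (suc e) {0ℤ} { -[1+ i ]} λ ()) ⟩
  multBelow (below h) i + 0
    ≡⟨ trans (+-identityʳ _) (multBelow-below h i) ⟩
  part h i ∎

multBelow-above : ∀ h i → multBelow (above h) i ≡ 0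
multBelow-above []      i = refl
multBelow-above (e ∷ h) i = begin
  multBelow (above (e ∷ h)) i
    ≡⟨ mult-levels-above-∷ e h (ℤ.- (+ i)) ⟩
  mult (replicate (suc e) 1ℤ) (ℤ.- (+ i)) + mult (levels (above h)) (ℤ.- (+ i) ℤ.- 1ℤ)
    ≡⟨ cong₂ _+_ (mult-replicate-≢ (suc e) (1≢-n i)) (cong (mult (levels (above h))) (-n-1 (+ i))) ⟩
  multBelow (above h) (suc i)
    ≡⟨ multBelow-above h (suc i) ⟩
  0 ∎

multAbove-above : ∀ h → multAbove (above h) ≗ part h
multAbove-above []      i       = refl
multAbove-above (e ∷ h) zero    = begin
  multAbove (above (e ∷ h)) 0                             ≡⟨ mult-levels-above-∷ e h 1ℤ ⟩
  mult (replicate (suc e) 1ℤ) 1ℤ + multBelow (above h) 0  ≡⟨ cong₂ _+_ (mult-replicate-≡ (suc e) 1ℤ) (multBelow-above h 0) ⟩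
  suc e + 0                                               ≡⟨ +-identityʳ (suc e) ⟩
  suc e                                                   ∎
multAbove-above (e ∷ h) (suc i) = begin
  multAbove (above (e ∷ h)) (suc i)
    ≡⟨ mult-levels-above-∷ e h (+ suc (suc i)) ⟩
  mult (replicate (suc e) 1ℤ) (+ suc (suc i)) + mult (levels (above h)) (+ suc (suc i) ℤ.- 1ℤ)
    ≡⟨ cong₂ _+_ (mult-replicate-≢ (suc e) {1ℤ} {+ suc (suc i)} λ ()) (cong (mult (levels (above h))) (suc-1 (+ suc i))) ⟩
  multAbove (above h) i
    ≡⟨ multAbove-above h i ⟩
  part h i ∎

Key₀ : Set
Key₀ = Composition × Composition

canon₀ : Key₀ → Word
canon₀ (a , b) = above b ++ below a

height-canon₀ : ∀ z → height (canon₀ z) ≡ 0ℤ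
height-canon₀ (a , b) = trans (height-++ (above b) (below a)) (cong₂ ℤ._+_ (height-above b) (height-below a))

countD-canon₀ : ∀ a b → countD (canon₀ (a , b)) ≡ weight a + weight b
countD-canon₀ a b = trans (countD-++ (above b) (below a)) (trans (cong₂ _+_ (countD-above b) (countD-below a)) (ℕ.+-comm (weight b) (weight a)))

multBelow-canon₀ : ∀ a b → multBelow (canon₀ (a , b)) ≗ part a
multBelow-canon₀ a b i = begin
  multBelow (canon₀ (a , b)) i                       ≡⟨ mult-levels-++-height0 (above b) (below a) (height-below a) (ℤ.- (+ i)) ⟩
  multBelow (above b) i + multBelow (below a) i      ≡⟨ cong₂ _+_ (multBelow-above b i) (multBelow-below a i) ⟩
  part a i                                           ∎

multAbove-canon₀ : ∀ a b → multAbove (canon₀ (a , b)) ≗ part b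
multAbove-canon₀ a b i = begin
  multAbove (canon₀ (a , b)) i                       ≡⟨ mult-levels-++-height0 (above b) (below a) (height-below a) (+ suc i) ⟩
  multAbove (above b) i + multAbove (below a) i      ≡⟨ cong₂ _+_ (multAbove-above b i) (multAbove-below a i) ⟩
  part b i + 0                                       ≡⟨ +-identityʳ (part b i) ⟩
  part b i                                           ∎

Key₁ : Set
Key₁ = Composition × ℕ × Composition

canon₁ : Key₁ → Word
canon₁ (a , n , b) = above b ++ UD^ n · (U ∷ below a)

height-UD^-U-below : ∀ n a → height (UD^ n · (U ∷ below a)) ≡ 1ℤ
height-UD^-U-below n a = trans (height-UD^ n (U ∷ below a)) (cong ℤ.suc (height-below a))

height-canon₁ : ∀ z → height (canon₁ z) ≡ 1ℤ
height-canon₁ (a , n , b) = trans (height-++ (above b) _) (cong₂ ℤ._+_ (height-above b) (height-UD^-U-below n a))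

countD-canon₁ : ∀ a n b → countD (canon₁ (a , n , b)) ≡ weight a + (n + weight b)
countD-canon₁ a n b = begin
  countD (above b ++ UD^ n · (U ∷ below a))          ≡⟨ countD-++ (above b) _ ⟩
  countD (above b) + countD (UD^ n · (U ∷ below a))  ≡⟨ cong (countD (above b) ℕ.+_) (countD-UD^ n (U ∷ below a)) ⟩
  countD (above b) + (n + countD (below a))          ≡⟨ cong₂ (λ x y → x + (n + y)) (countD-above b) (countD-below a) ⟩
  weight b + (n + weight a)                          ≡⟨ swap (weight b) n (weight a) ⟩
  weight a + (n + weight b)                          ∎
  where swap : ∀ x n y → x + (n + y) ≡ y + (n + x)
        swap = solve-∀

mult-levels-canon₁ : ∀ a n b x →
  mult (levels (canon₁ (a , n , b))) x ≡ mult (levels (above b)) (x ℤ.- 1ℤ) + (mult (replicate n 1ℤ) x + mult (levels (below a)) x)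
mult-levels-canon₁ a n b x = begin
  mult (levels (canon₁ (a , n , b))) x
    ≡⟨ mult-levels-++ (above b) (UD^ n · (U ∷ below a)) x ⟩
  mult (levels (above b)) (x ℤ.- height (UD^ n · (U ∷ below a))) + mult (levels (UD^ n · (U ∷ below a))) x
    ≡⟨ cong₂ (λ h m → mult (levels (above b)) (x ℤ.- h) + m) (height-UD^-U-below n a) (mult-levels-UD^ n (U ∷ below a) x) ⟩
  mult (levels (above b)) (x ℤ.- 1ℤ) + (mult (replicate n (ℤ.suc (height (below a)))) x + mult (levels (below a)) x)
    ≡⟨ cong (λ h → mult (levels (above b)) (x ℤ.- 1ℤ) + (mult (replicate n (ℤ.suc h)) x + mult (levels (below a)) x)) (height-below a) ⟩
  mult (levels (above b)) (x ℤ.- 1ℤ) + (mult (replicate n 1ℤ) x + mult (levels (below a)) x) ∎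

multBelow-canon₁ : ∀ a n b → multBelow (canon₁ (a , n , b)) ≗ part a
multBelow-canon₁ a n b i = begin
  multBelow (canon₁ (a , n , b)) i
    ≡⟨ mult-levels-canon₁ a n b (ℤ.- (+ i)) ⟩
  mult (levels (above b)) (ℤ.- (+ i) ℤ.- 1ℤ) + (mult (replicate n 1ℤ) (ℤ.- (+ i)) + multBelow (below a) i)
    ≡⟨ cong₂ _+_ (trans (cong (mult (levels (above b))) (-n-1 (+ i))) (multBelow-above b (suc i)))
                 (cong₂ _+_ (mult-replicate-≢ n (1≢-n i)) (multBelow-below a i)) ⟩
  part a i ∎

multAbove-canon₁-0 : ∀ a n b → multAbove (canon₁ (a , n , b)) 0 ≡ n
multAbove-canon₁-0 a n b = begin
  multAbove (canon₁ (a , n , b)) 0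
    ≡⟨ mult-levels-canon₁ a n b 1ℤ ⟩
  multBelow (above b) 0 + (mult (replicate n 1ℤ) 1ℤ + multAbove (below a) 0)
    ≡⟨ cong₂ _+_ (multBelow-above b 0) (cong₂ _+_ (mult-replicate-≡ n 1ℤ) (multAbove-below a 0)) ⟩
  n + 0
    ≡⟨ +-identityʳ n ⟩
  n ∎

multAbove-canon₁-suc : ∀ a n b → multAbove (canon₁ (a , n , b)) ∘ suc ≗ part b
multAbove-canon₁-suc a n b i = begin
  multAbove (canon₁ (a , n , b)) (suc i)
    ≡⟨ mult-levels-canon₁ a n b (+ suc (suc i)) ⟩
  mult (levels (above b)) (+ suc (suc i) ℤ.- 1ℤ) + (mult (replicate n 1ℤ) (+ suc (suc i)) + multAbove (below a) (suc i))
    ≡⟨ cong₂ _+_ (trans (cong (mult (levels (above b))) (suc-1 (+ suc i))) (multAbove-above b i))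
                 (cong₂ _+_ (mult-replicate-≢ n {1ℤ} {+ suc (suc i)} λ ()) (multAbove-below a (suc i))) ⟩
  part b i + 0
    ≡⟨ +-identityʳ (part b i) ⟩
  part b i ∎

key₀ : Word → Key₀
key₀ w = readBelow w , readAbove 0 w

key₁ : Word → Key₁
key₁ w = readBelow w , multAbove w 0 , readAbove 1 w

canon₀-key₀ : ∀ w → height w ≡ 0ℤ → mult (levels (canon₀ (key₀ w))) ≗ mult (levels w)
canon₀-key₀ w flat = mult-levels-≗ (canon₀ (key₀ w)) w
  (λ i → trans (multBelow-canon₀ (readBelow w) (readAbove 0 w) i) (part-readBelow w i))
  (λ i → trans (multAbove-canon₀ (readBelow w) (readAbove 0 w) i) (part-readAbove w flat i))

canon₁-key₁ : ∀ w → height w ≡ 1ℤ → mult (levels (canon₁ (key₁ w))) ≗ mult (levels w)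
canon₁-key₁ w h≡1 = mult-levels-≗ (canon₁ (key₁ w)) w (λ i → trans (multBelow-canon₁ a n b i) (part-readBelow w i)) aboves
  where
  a = readBelow w
  n = multAbove w 0
  b = readAbove 1 w
  aboves : multAbove (canon₁ (a , n , b)) ≗ multAbove w
  aboves zero    = multAbove-canon₁-0 a n b
  aboves (suc i) = trans (multAbove-canon₁-suc a n b i) (part-readAbove w h≡1 i)

canon₀-injective : ∀ z z′ → mult (levels (canon₀ z)) ≗ mult (levels (canon₀ z′)) → z ≡ z′
canon₀-injective (a , b) (a′ , b′) eq = cong₂ _,_
  (part-injective a a′ λ i → trans (sym (multBelow-canon₀ a b i)) (trans (eq (ℤ.- (+ i))) (multBelow-canon₀ a′ b′ i)))
  (part-injective b b′ λ i → trans (sym (multAbove-canon₀ a b i)) (trans (eq (+ suc i)) (multAbove-canon₀ a′ b′ i)))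

canon₁-injective : ∀ z z′ → mult (levels (canon₁ z)) ≗ mult (levels (canon₁ z′)) → z ≡ z′
canon₁-injective (a , n , b) (a′ , n′ , b′) eq = cong₂ _,_
  (part-injective a a′ λ i → trans (sym (multBelow-canon₁ a n b i)) (trans (eq (ℤ.- (+ i))) (multBelow-canon₁ a′ n′ b′ i)))
  (cong₂ _,_
    (trans (sym (multAbove-canon₁-0 a n b)) (trans (eq 1ℤ) (multAbove-canon₁-0 a′ n′ b′)))
    (part-injective b b′ λ i →
      trans (sym (multAbove-canon₁-suc a n b i)) (trans (eq (+ suc (suc i))) (multAbove-canon₁-suc a′ n′ b′ i))))

height-InClass : ∀ {n k} w → InClass n k w → height w ℤ.+ + (k + k) ≡ + n
height-InClass w (refl , refl) = height-length w

InClass-even⇔ : ∀ k w → InClass (2 * k) k w ⇔ (height w ≡ 0ℤ × countD w ≡ k)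
InClass-even⇔ k w = mk⇔
  (λ w∈ → +-cancelʳ (+ (k + k)) _ _ (trans (height-InClass w w∈) (cong +_ (2*m≡m+m k))) , proj₂ w∈)
  (λ { (h≡0 , refl) → trans (height⇒length w h≡0) (sym (2*m≡m+m k)) , refl })

InClass-odd⇔ : ∀ k w → InClass (2 * k + 1) k w ⇔ (height w ≡ 1ℤ × countD w ≡ k)
InClass-odd⇔ k w = mk⇔
  (λ w∈ → +-cancelʳ (+ (k + k)) _ _ (trans (height-InClass w w∈) (cong +_ 2k+1≡1+[k+k])) , proj₂ w∈)
  (λ { (h≡1 , refl) → trans (height⇒length w h≡1) (sym 2k+1≡1+[k+k]) , refl })
  where 2k+1≡1+[k+k] : 2 * k + 1 ≡ suc (k + k)
        2k+1≡1+[k+k] = trans (ℕ.+-comm (2 * k) 1) (cong suc (2*m≡m+m k))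

mult-levels-≗⇒countD-≡ : ∀ u v → mult (levels u) ≗ mult (levels v) → countD u ≡ countD v
mult-levels-≗⇒countD-≡ u v eq = begin
  countD u                ≡⟨ length-levels u ⟨
  length (levels u)       ≡⟨ ↭-length (mult-≗⇒↭ (levels u) (levels v) eq) ⟩
  length (levels v)       ≡⟨ length-levels v ⟩
  countD v                ∎

numClasses-by-keys :
  ∀ {n k c} {Key : Set} (canon : Key → Word) (key : Word → Key) (keys : List Key) →
  (∀ w → InClass n k w ⇔ (height w ≡ c × countD w ≡ k)) →
  (∀ z → height (canon z) ≡ c) →
  (∀ z → z ∈ keys ⇔ countD (canon z) ≡ k) →
  Unique keys →
  (∀ z z′ → mult (levels (canon z)) ≗ mult (levels (canon z′)) → z ≡ z′) →
  (∀ w → height w ≡ c → mult (levels (canon (key w))) ≗ mult (levels w)) →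
  NumClasses n k (length keys)
numClasses-by-keys {n} {k} canon key keys class⇔ height-canon keys⇔ unique canon-injective canon-key =
  map canon keys , length-map canon keys , All.map⁺ (All.tabulate in-class) , AllPairs.map⁺ (AllPairs.map distinct unique) , complete
  where
  in-class : ∀ {z} → z ∈ keys → InClass n k (canon z)
  in-class {z} z∈ = Equivalence.from (class⇔ (canon z)) (height-canon z , Equivalence.to (keys⇔ z) z∈)
  distinct : ∀ {z z′} → z ≢ z′ → ¬ WeylEquiv (canon z) (canon z′)
  distinct {z} {z′} z≢z′ z∼z′ = z≢z′ (canon-injective z z′ (↭⇒mult-≗
    (Equivalence.to (WeylEquiv⇔levels-↭ (canon z) (canon z′) (trans (height-canon z) (sym (height-canon z′)))) z∼z′)))
  complete : ∀ w → InClass n k w → Any (WeylEquiv w) (map canon keys)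
  complete w w∈ = Any.map⁺ (Any.map (λ { refl → w∼canon }) key∈)
    where
    height-w = proj₁ (Equivalence.to (class⇔ w) w∈)
    same = canon-key w height-w
    key∈ : key w ∈ keys
    key∈ = Equivalence.from (keys⇔ (key w))
             (trans (mult-levels-≗⇒countD-≡ (canon (key w)) w same) (proj₂ (Equivalence.to (class⇔ w) w∈)))
    w∼canon : WeylEquiv w (canon (key w))
    w∼canon = Equivalence.from (WeylEquiv⇔levels-↭ w (canon (key w)) (trans height-w (sym (height-canon (key w)))))
                               (↭.↭-sym (mult-≗⇒↭ _ _ same))

keys₀ : ℕ → List Key₀
keys₀ = pairs compositions compositions

keys₁ : ℕ → List Key₁
keys₁ = pairs compositions (pairs [_] compositions)

keys₀-unique : ∀ k → Unique (keys₀ k)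
keys₀-unique = pairs-unique ∈-compositions⇒≡ compositions-unique compositions-unique

keys₁-unique : ∀ k → Unique (keys₁ k)
keys₁-unique = pairs-unique ∈-compositions⇒≡ compositions-unique
                 (pairs-unique (λ { (here refl) (here refl) → refl }) (λ _ → [] ∷ []) compositions-unique)

∈-keys₀⇔ : ∀ k z → z ∈ keys₀ k ⇔ countD (canon₀ z) ≡ k
∈-keys₀⇔ k (a , b) = mk⇔
  (λ z∈ → let i , j , i+j≡k , a∈ , b∈ = ∈-pairs⁻ {E = compositions} {compositions} k z∈ in
          trans (countD-canon₀ a b) (trans (cong₂ _+_ (∈-compositions⇒weight i a∈) (∈-compositions⇒weight j b∈)) i+j≡k))
  (λ d≡k → subst (λ m → (a , b) ∈ keys₀ m) (trans (sym (countD-canon₀ a b)) d≡k)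
                 (∈-pairs⁺ (weight a) (weight b) (∈-compositions a) (∈-compositions b)))

∈-keys₁⇔ : ∀ k z → z ∈ keys₁ k ⇔ countD (canon₁ z) ≡ k
∈-keys₁⇔ k (a , n , b) = mk⇔
  (λ z∈ → let i , j , i+j≡k , a∈ , nb∈ = ∈-pairs⁻ {E = compositions} {pairs [_] compositions} k z∈
              n′ , j′ , n′+j′≡j , n∈ , b∈ = ∈-pairs⁻ {E = [_]} {compositions} j nb∈ in
          trans (countD-canon₁ a n b)
                (trans (cong₂ (λ x y → x + (n + y)) (∈-compositions⇒weight i a∈) (∈-compositions⇒weight j′ b∈))
                       (trans (cong (i ℕ.+_) (trans (cong (_+ j′) (∈-singleton⇒≡ n∈)) n′+j′≡j)) i+j≡k)))
  (λ d≡k → subst (λ m → (a , n , b) ∈ keys₁ m) (trans (sym (countD-canon₁ a n b)) d≡k)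
                 (∈-pairs⁺ (weight a) (n + weight b) (∈-compositions a) (∈-pairs⁺ n (weight b) (here refl) (∈-compositions b))))
  where ∈-singleton⇒≡ : ∀ {x y : ℕ} → x ∈ [ y ] → x ≡ y
        ∈-singleton⇒≡ (here x≡y) = x≡y

numClasses-even : ∀ k → NumClasses (2 * k) k (length (keys₀ k))
numClasses-even k = numClasses-by-keys canon₀ key₀ (keys₀ k)
  (InClass-even⇔ k) height-canon₀ (∈-keys₀⇔ k) (keys₀-unique k) canon₀-injective canon₀-key₀

numClasses-odd : ∀ k → NumClasses (2 * k + 1) k (length (keys₁ k))
numClasses-odd k = numClasses-by-keys canon₁ key₁ (keys₁ k)
  (InClass-odd⇔ k) height-canon₁ (∈-keys₁⇔ k) (keys₁-unique k) canon₁-injective canon₁-key₁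

-- Counting

#compositions : ℕ → ℕ
#compositions = length ∘ compositions

convolution-1-#compositions : ∀ n → convolution (λ _ → 1) #compositions n ≡ 2 ^ n
convolution-1-#compositions zero    = refl
convolution-1-#compositions (suc n) = begin
  1 * #compositions (suc n) + convolution (λ _ → 1) #compositions n ≡⟨ cong₂ _+_ (ℕ.*-identityˡ _) (convolution-1-#compositions n) ⟩
  #compositions (suc n) + 2 ^ n                                    ≡⟨ cong (_+ 2 ^ n) (length-compositions n) ⟩
  2 ^ n + 2 ^ n                                                    ≡⟨ 2*m≡m+m (2 ^ n) ⟨
  2 ^ suc n                                                        ∎

length-keys₀ : ∀ k → length (keys₀ k) ≡ convolution #compositions #compositions k
length-keys₀ = length-pairs compositions compositions

length-keys₁ : ∀ k → length (keys₁ k) ≡ convolution #compositions (2 ^_) k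
length-keys₁ k = trans (length-pairs compositions (pairs [_] compositions) k)
  (convolution-cong (λ _ → refl) (λ j → trans (length-pairs [_] compositions j) (convolution-1-#compositions j)) k)

convolution-2^-2^ : ∀ n → convolution (2 ^_) (2 ^_) n ≡ suc n * 2 ^ n
convolution-2^-2^ zero    = refl
convolution-2^-2^ (suc n) = begin
  1 * 2 ^ suc n + convolution (λ i → 2 * 2 ^ i) (2 ^_) n ≡⟨ cong (1 * 2 ^ suc n ℕ.+_) (convolution-double (2 ^_) (2 ^_) n) ⟩
  1 * 2 ^ suc n + 2 * convolution (2 ^_) (2 ^_) n        ≡⟨ cong (λ c → 1 * 2 ^ suc n + 2 * c) (convolution-2^-2^ n) ⟩
  1 * (2 * 2 ^ n) + 2 * (suc n * 2 ^ n)                  ≡⟨ closed n (2 ^ n) ⟩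
  suc (suc n) * (2 * 2 ^ n)                              ∎
  where closed : ∀ n p → 1 * (2 * p) + 2 * ((1 + n) * p) ≡ (2 + n) * (2 * p)
        closed = solve-∀

convolution-2^-#compositions : ∀ n → 2 * convolution (2 ^_) #compositions n ≡ (n + 2) * 2 ^ n
convolution-2^-#compositions zero    = refl
convolution-2^-#compositions (suc n) = begin
  2 * (1 * #compositions (suc n) + convolution (λ i → 2 * 2 ^ i) #compositions n)
    ≡⟨ cong₂ (λ c d → 2 * (1 * c + d)) (length-compositions n)
             (trans (convolution-double (2 ^_) #compositions n) (convolution-2^-#compositions n)) ⟩
  2 * (1 * 2 ^ n + (n + 2) * 2 ^ n)
    ≡⟨ closed n (2 ^ n) ⟩
  (suc n + 2) * (2 * 2 ^ n) ∎
  where closed : ∀ n p → 2 * (1 * p + (n + 2) * p) ≡ ((1 + n) + 2) * (2 * p)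
        closed = solve-∀

count-even : ∀ n → 4 * convolution #compositions #compositions (suc n) ≡ (suc n + 3) * 2 ^ suc n
count-even n = begin
  4 * (1 * #compositions (suc n) + convolution (#compositions ∘ suc) #compositions n)
    ≡⟨ cong₂ (λ c d → 4 * (1 * c + d)) (length-compositions n) (convolution-cong length-compositions (λ _ → refl) n) ⟩
  4 * (1 * 2 ^ n + c)
    ≡⟨ regroup (2 ^ n) c ⟩
  4 * 2 ^ n + 2 * (2 * c)
    ≡⟨ cong (λ d → 4 * 2 ^ n + 2 * d) (convolution-2^-#compositions n) ⟩
  4 * 2 ^ n + 2 * ((n + 2) * 2 ^ n)
    ≡⟨ closed n (2 ^ n) ⟩
  (suc n + 3) * (2 * 2 ^ n) ∎
  where c = convolution (2 ^_) #compositions n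
        regroup : ∀ p c → 4 * (1 * p + c) ≡ 4 * p + 2 * (2 * c)
        regroup = solve-∀
        closed : ∀ n p → 4 * p + 2 * ((n + 2) * p) ≡ ((1 + n) + 3) * (2 * p)
        closed = solve-∀

count-odd : ∀ k → 2 * convolution #compositions (2 ^_) k ≡ (k + 2) * 2 ^ k
count-odd zero    = refl
count-odd (suc n) = begin
  2 * (1 * 2 ^ suc n + convolution (#compositions ∘ suc) (2 ^_) n)
    ≡⟨ cong (λ c → 2 * (1 * 2 ^ suc n + c)) (trans (convolution-cong length-compositions (λ _ → refl) n) (convolution-2^-2^ n)) ⟩
  2 * (1 * (2 * 2 ^ n) + suc n * 2 ^ n)
    ≡⟨ closed n (2 ^ n) ⟩
  (suc n + 2) * (2 * 2 ^ n) ∎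
  where closed : ∀ n p → 2 * (1 * (2 * p) + (1 + n) * p) ≡ ((1 + n) + 2) * (2 * p)
        closed = solve-∀

lemma6p3 : (k : ℕ) → 0 < k →
    (Σ ℕ λ N → (4 * N ≡ (k + 3) * 2 ^ k) × NumClasses (2 * k) k N)
    × (Σ ℕ λ N → (2 * N ≡ (k + 2) * 2 ^ k) × NumClasses (2 * k + 1) k N)
lemma6p3 (suc k) _ =
  (length (keys₀ (suc k)) , trans (cong (4 *_) (length-keys₀ (suc k))) (count-even k) , numClasses-even (suc k)) ,
  (length (keys₁ (suc k)) , trans (cong (2 *_) (length-keys₁ (suc k))) (count-odd (suc k)) , numClasses-odd (suc k))
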